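{- Let $\mathcal C$ be a 3XOR instance on variable set $\mathcal X$ and suppose that there is no SOS refutation of $\mathcal C$ of degree at most $r$ (i.e., a degree-$r$ pseudo-expectation for $\mathcal C$ exists). Then there is no SOS refutation of the statement "$G_{\mathcal C}$ and $G_{\overline{\mathcal C}}$ are isomorphic" of degree at most $r/3$ (i.e., a degree-$\lfloor r/3\rfloor$ pseudo-expectation for the isomorphism of $G_{\mathcal C}$ and $G_{\overline{\mathcal C}}$ exists).
   Context: 3XOR instances, the homogeneous version $\overline{\mathcal C}$ (every right-hand side replaced by $0$), and the graph $G_{\mathcal C}$: variable vertices "$x\mapsto a$" ($x\in\mathcal X$, $a\in\mathbb Z_2$) with an edge between $x\mapsto0$ and $x\mapsto1$; for each constraint $C$ on variables $x_1,x_2,x_3$, four constraint vertices, one per satisfying partial assignment $(x_1\mapsto a_1,x_2\mapsto a_2,x_3\mapsto a_3)$ of $C$, forming a clique, each joined to the three variable vertices consistent with it; variable vertices are shared across constraints. $G_{\mathcal C}$ and $G_{\overline{\mathcal C}}$ have the same numbers of vertices and edges. A degree-$r$ pseudo-expectation for $\mathcal C$ is a linear functional $\tilde{\mathbb E}$ on real polynomials of degree $\le r$ in indeterminates $A[x\mapsto a]$ ($x\in\mathcal X,a\in\mathbb Z_2$) with $\tilde{\mathbb E}[1]=1$ such that (whenever the argument has degree $\le r$): $\tilde{\mathbb E}[(A[x\mapsto a]^2-A[x\mapsto a])q]=0$; $\tilde{\mathbb E}[(A[x\mapsto0]+A[x\mapsto1]-1)q]=0$; for each $C\in\mathcal C$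 on $x_1,x_2,x_3$, $\tilde{\mathbb E}[(\sum_{\alpha\text{ satisfying }C}A[x_1\mapsto\alpha(x_1)]A[x_2\mapsto\alpha(x_2)]A[x_3\mapsto\alpha(x_3)]-1)q]=0$; and $\tilde{\mathbb E}[p^2]\ge0$, for all polynomials $q,p$. A degree-$r$ SOS refutation of $\mathcal C$ exists iff no such functional exists. For graphs $G,H$ with equal vertex and edge counts, a degree-$r$ pseudo-expectation for their isomorphism is a linear functional $\tilde{\mathbb E}$ on polynomials of degree $\le r$ in indeterminates $\Pi[u\mapsto v]$ ($u\in V(G),v\in V(H)$) with $\tilde{\mathbb E}[1]=1$ such that (whenever degree $\le r$): $\tilde{\mathbb E}[(\Pi[u\mapsto v]^2-\Pi[u\mapsto v])q]=0$; $\tilde{\mathbb E}[(\sum_{v}\Pi[u\mapsto v]-1)q]=0$ for each $u$ and $\tilde{\mathbb E}[(\sum_{u}\Pi[u\mapsto v]-1)q]=0$ for each $v$; $\tilde{\mathbb E}[(\sum_{\{u,u'\}\in E(G)}\sum_{v,v':\{v,v'\}\in E(H)}\Pi[u\mapsto v]\Pi[u'\mapsto v']-|E(G)|)p^2]\ge0$; $\tilde{\mathbb E}[p^2]\ge0$, for all polynomials $q,p$. A degree-$r$ SOS refutation of the isomorphism exists iff no such functional exists. -}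

module Defs where

open import Data.Nat using (ℕ; zero; suc; _⊔_) renaming (_≤_ to _≤ℕ_)
open import Data.Bool using (Bool; true; false; _xor_)
open import Data.Fin using (Fin)
open import Data.List using (List; []; _∷_; _++_; map; concatMap; foldr; length; [_]; allFin)
open import Data.List.Relation.Binary.Permutation.Propositional using (_↭_)
open import Data.Product using (_×_; _,_; ∃)
open import Data.Sum using (_⊎_; inj₁; inj₂)
open import Relation.Binary.PropositionalEquality using (_≡_)
open import Relation.Nullary using (¬_)
open import Algebra.Structures using (IsCommutativeRing)
open import Relation.Binary.Structures using (IsTotalOrder)

-- The real numbers, given axiomatically as a complete ordered field.
-- Statements quantify over every such structure (all are isomorphic to ℝ).

record RealField : Set₁ where
  infixl 6 _+_
  infixl 7 _*_
  infix 4 _≤_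
  field
    R : Set
    _+_ _*_ : R → R → R
    -_ : R → R
    0r 1r : R
    _≤_ : R → R → Set
    isCommutativeRing : IsCommutativeRing _≡_ _+_ _*_ -_ 0r 1r
    0≢1 : ¬ (0r ≡ 1r)
    inverse : ∀ x → ¬ (x ≡ 0r) → ∃ λ y → x * y ≡ 1r
    isTotalOrder : IsTotalOrder _≡_ _≤_
    +-mono : ∀ {x y} z → x ≤ y → x + z ≤ y + z
    *-nonneg : ∀ {x y} → 0r ≤ x → 0r ≤ y → 0r ≤ x * y
    complete : (S : R → Set) → ∃ S → (∃ λ b → ∀ x → S x → x ≤ b) →
      ∃ λ s → (∀ x → S x → x ≤ s) × (∀ b → (∀ x → S x → x ≤ b) → s ≤ b)

  fromℕ : ℕ → R
  fromℕ zero = 0r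
  fromℕ (suc k) = 1r + fromℕ k

-- Real polynomials in indeterminates from a set I, as formal sums of
-- terms (coefficient , monomial); a monomial is a list of indeterminates
-- (read as a multiset).

module Polynomials (ℝ : RealField) (I : Set) where
  open RealField ℝ

  Monomial : Set
  Monomial = List I

  Polynomial : Set
  Polynomial = List (R × Monomial)

  const : R → Polynomial
  const c = [ (c , []) ]

  var : I → Polynomial
  var i = [ (1r , [ i ]) ]

  infixl 6 _⊕_ _⊖_
  infixl 7 _⊗_

  _⊕_ : Polynomial → Polynomial → Polynomial
  p ⊕ q = p ++ q

  ⊝_ : Polynomial → Polynomial
  ⊝ p = map (λ { (c , m) → (- c , m) }) p

  _⊖_ : Polynomial → Polynomial → Polynomial
  p ⊖ q = p ⊕ (⊝ q)

  _⊗_ : Polynomial → Polynomial → Polynomial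
  p ⊗ q = concatMap (λ { (c , m) → map (λ { (d , k) → (c * d , m ++ k) }) q }) p

  ∑ : List Polynomial → Polynomial
  ∑ = foldr _⊕_ []

  deg : Polynomial → ℕ
  deg = foldr (λ { (c , m) d → length m ⊔ d }) 0

  record Functional : Set where
    field
      L : Monomial → R
      L-sym : ∀ {m k} → m ↭ k → L m ≡ L k

    𝔼 : Polynomial → R
    𝔼 = foldr (λ { (c , m) s → c * L m + s }) 0r

  Annihilates : Functional → ℕ → Polynomial → Set
  Annihilates E r g = ∀ q → deg (g ⊗ q) ≤ℕ r → Functional.𝔼 E (g ⊗ q) ≡ 0r

  NonNegOn : Functional → ℕ → Polynomial → Set
  NonNegOn E r g = ∀ p → deg (g ⊗ (p ⊗ p)) ≤ℕ r → 0r ≤ Functional.𝔼 E (g ⊗ (p ⊗ p))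

  PSD : Functional → ℕ → Set
  PSD E r = ∀ p → deg (p ⊗ p) ≤ℕ r → 0r ≤ Functional.𝔼 E (p ⊗ p)

-- 3XOR instances on variable set Fin n with m constraints; ℤ₂ is Bool,
-- addition in ℤ₂ is _xor_.  Constraint: x₁ + x₂ + x₃ = rhs.

record XORConstraint (n : ℕ) : Set where
  field
    x₁ x₂ x₃ : Fin n
    rhs : Bool
    x₁≢x₂ : ¬ (x₁ ≡ x₂)
    x₁≢x₃ : ¬ (x₁ ≡ x₃)
    x₂≢x₃ : ¬ (x₂ ≡ x₃)

Instance : ℕ → ℕ → Set
Instance n m = Fin m → XORConstraint n

homogeneous : ∀ {n m} → Instance n m → Instance n m
homogeneous C i = record (C i) { rhs = false }

bools : List Bool
bools = false ∷ true ∷ []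

-- the four satisfying assignments of a constraint are indexed by (a₁ , a₂);
-- the value of x₃ is then a₁ + a₂ + rhs
labels : List (Bool × Bool)
labels = concatMap (λ a → map (a ,_) bools) bools

third : ∀ {n} → XORConstraint n → Bool → Bool → Bool
third c a₁ a₂ = (a₁ xor a₂) xor XORConstraint.rhs c

-- Finite simple graphs given by a vertex enumeration and a list of
-- edges (each unordered edge {u , v} listed once, as (u , v)).

record Graph : Set₁ where
  field
    V : Set
    vertices : List V
    edges : List (V × V)

pairs : {A : Set} → List A → List (A × A)
pairs [] = []
pairs (x ∷ xs) = map (x ,_) xs ++ pairs xs

-- vertices of G_C: variable vertices x ↦ a and constraint vertices (C , α)
Vert : ℕ → ℕ → Set
Vert n m = (Fin n × Bool) ⊎ (Fin m × (Bool × Bool))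

G[_] : ∀ {n m} → Instance n m → Graph
G[_] {n} {m} C = record
  { V = Vert n m
  ; vertices = map inj₁ (concatMap (λ x → map (x ,_) bools) (allFin n))
             ++ map inj₂ (concatMap (λ i → map (i ,_) labels) (allFin m))
  ; edges = map (λ x → (inj₁ (x , false) , inj₁ (x , true))) (allFin n)
          ++ concatMap (λ i → map (λ { (α , β) → (inj₂ (i , α) , inj₂ (i , β)) }) (pairs labels)) (allFin m)
          ++ concatMap (λ i → concatMap (λ { (a₁ , a₂) →
                 (inj₂ (i , (a₁ , a₂)) , inj₁ (XORConstraint.x₁ (C i) , a₁))
               ∷ (inj₂ (i , (a₁ , a₂)) , inj₁ (XORConstraint.x₂ (C i) , a₂))
               ∷ (inj₂ (i , (a₁ , a₂)) , inj₁ (XORConstraint.x₃ (C i) , third (C i) a₁ a₂))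
               ∷ [] }) labels) (allFin m)
  }

module _ (ℝ : RealField) {n m : ℕ} (C : Instance n m) (r : ℕ) where
  open RealField ℝ using (1r)
  open Polynomials ℝ (Fin n × Bool)

  A[_↦_] : Fin n → Bool → Polynomial
  A[ x ↦ a ] = var (x , a)

  constraintPoly : Fin m → Polynomial
  constraintPoly i = ∑ (map (λ { (a₁ , a₂) →
      A[ XORConstraint.x₁ (C i) ↦ a₁ ] ⊗ A[ XORConstraint.x₂ (C i) ↦ a₂ ]
        ⊗ A[ XORConstraint.x₃ (C i) ↦ third (C i) a₁ a₂ ] }) labels)
    ⊖ const 1r

  record PseudoExpectation3XOR : Set where
    field
      E : Functional
      normalised : Functional.𝔼 E (const 1r) ≡ 1r
      booleanity : ∀ x a → Annihilates E r (A[ x ↦ a ] ⊗ A[ x ↦ a ] ⊖ A[ x ↦ a ])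
      one-value : ∀ x → Annihilates E r (A[ x ↦ false ] ⊕ A[ x ↦ true ] ⊖ const 1r)
      constraints : ∀ i → Annihilates E r (constraintPoly i)
      psd : PSD E r

module _ (ℝ : RealField) (G H : Graph) (r : ℕ) where
  open RealField ℝ using (1r; fromℕ)
  open Graph
  open Polynomials ℝ (V G × V H)

  Π[_↦_] : V G → V H → Polynomial
  Π[ u ↦ v ] = var (u , v)

  edgePoly : Polynomial
  edgePoly = ∑ (map (λ { (u , u') → ∑ (map (λ { (v , v') →
      Π[ u ↦ v ] ⊗ Π[ u' ↦ v' ] ⊕ Π[ u ↦ v' ] ⊗ Π[ u' ↦ v ] }) (edges H)) }) (edges G))

  record PseudoExpectationIso : Set where
    field
      E : Functional
      normalised : Functional.𝔼 E (const 1r) ≡ 1r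
      booleanity : ∀ u v → Annihilates E r (Π[ u ↦ v ] ⊗ Π[ u ↦ v ] ⊖ Π[ u ↦ v ])
      rows : ∀ u → Annihilates E r (∑ (map (λ v → Π[ u ↦ v ]) (vertices H)) ⊖ const 1r)
      cols : ∀ v → Annihilates E r (∑ (map (λ u → Π[ u ↦ v ]) (vertices G)) ⊖ const 1r)
      edge : NonNegOn E r (edgePoly ⊖ const (fromℕ (length (edges G))))
      psd : PSD E r

-- A solution s of C induces an isomorphism G[ C ] ≅ G[ C̄ ]: the vertex x ↦ a goes to x ↦ a + s(x),
-- and the vertex (i , α) of the i-th constraint goes to (i , α + s restricted to that constraint).
-- Writing the entries of its permutation matrix as polynomials in the indicators A[ x ↦ a ] of s
-- gives a substitution σ of degree 3 from the Π-variables to the A-variables. Pulling a degree-r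
-- pseudo-expectation Ẽ for C back along σ gives a degree-⌊r/3⌋ pseudo-expectation for the
-- isomorphism: σ is multiplicative, so squares go to squares, and σ sends every isomorphism axiom
-- into the degree-r part of the ideal generated by the 3XOR axioms, which Ẽ annihilates.
module Submission where

open import Data.Bool using (Bool; true; false; _xor_; not)
import Data.Bool.Properties as Boolₚ
open import Data.Empty using (⊥-elim)
open import Data.Fin as Fin using (Fin; #_)
import Data.Fin.Properties as Finₚ
open import Data.List using (List; []; _∷_; _++_; map; concatMap; foldr; length; allFin; tabulate)
import Data.List.Properties as Listₚ
open import Data.List.Membership.Propositional using (_∈_)
import Data.List.Membership.Propositional.Properties as ∈ₚ
open import Data.List.Relation.Binary.Permutation.Propositional using (_↭_)
import Data.List.Relation.Binary.Permutation.Propositional as ↭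
import Data.List.Relation.Binary.Permutation.Propositional.Properties as ↭ₚ
open import Data.List.Relation.Unary.All as All using (All; []; _∷_)
import Data.List.Relation.Unary.All.Properties as Allₚ
open import Data.List.Relation.Unary.Any using (here; there)
open import Data.Nat as ℕ using (ℕ; suc; _⊔_; z≤n; s≤s) renaming (_≤_ to _≤ℕ_)
open import Data.Nat.DivMod using (_/_; m/n*n≤m)
import Data.Nat.Properties as ℕₚ
open import Data.Product using (_×_; _,_; proj₁; proj₂; ∃)
import Data.Product.Properties as ×ₚ
open import Data.Sum using (inj₁; inj₂)
open import Data.Vec using (Vec) renaming ([] to []ᵥ; _∷_ to _∷ᵥ_)
open import Function using (_∘_; id)
open import Level using (0ℓ)
open import Relation.Nullary using (¬_; Dec; yes; no)
open import Relation.Binary.Bundles using (Setoid)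
open import Relation.Binary.Definitions using (DecidableEquality)
open import Relation.Binary.PropositionalEquality
  using (_≡_; _≢_; refl; sym; trans; cong; cong₂; subst; ≡-≟-identity; ≢-≟-identity; module ≡-Reasoning)
import Relation.Binary.Reasoning.Setoid as SetoidReasoning
open import Relation.Binary.Structures using (IsTotalOrder)
open import Algebra.Bundles using (CommutativeRing; CommutativeMonoid)
import Algebra.Properties.CommutativeSemigroup as CommutativeSemigroupProperties
import Algebra.Properties.Ring as RingProperties
import Algebra.Solver.CommutativeMonoid as CommutativeMonoidSolver

open import Defs

infixl 6 _⊞_
_⊞_ : Bool × Bool → Bool × Bool → Bool × Bool
(a₁ , a₂) ⊞ (b₁ , b₂) = (a₁ xor b₁ , a₂ xor b₂)

infix 4 _≟₂_
_≟₂_ : DecidableEquality (Bool × Bool)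
_≟₂_ = ×ₚ.≡-dec Boolₚ._≟_ Boolₚ._≟_

⊞-comm : ∀ α β → α ⊞ β ≡ β ⊞ α
⊞-comm (a₁ , a₂) (b₁ , b₂) = cong₂ _,_ (Boolₚ.xor-comm a₁ b₁) (Boolₚ.xor-comm a₂ b₂)

third-⊞ : ∀ {n} (c : XORConstraint n) α γ →
  third c (proj₁ α) (proj₂ α) xor third (record c { rhs = false }) (proj₁ γ) (proj₂ γ)
    ≡ third c (proj₁ (α ⊞ γ)) (proj₂ (α ⊞ γ))
third-⊞ c (a₁ , a₂) (g₁ , g₂) =
  prove 5 (((a₁′ ⊹ a₂′) ⊹ c′) ⊹ ((g₁′ ⊹ g₂′) ⊹ ∅)) (((a₁′ ⊹ g₁′) ⊹ (a₂′ ⊹ g₂′)) ⊹ c′)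
    (a₁ ∷ᵥ a₂ ∷ᵥ g₁ ∷ᵥ g₂ ∷ᵥ XORConstraint.rhs c ∷ᵥ []ᵥ)
  where
  open CommutativeMonoidSolver (CommutativeRing.+-commutativeMonoid Boolₚ.xor-∧-commutativeRing)
    using (Expr; prove) renaming (var to ⟨_⟩; id to ∅; _⊕_ to _⊹_)
  a₁′ a₂′ g₁′ g₂′ c′ : Expr 5
  a₁′ = ⟨ # 0 ⟩
  a₂′ = ⟨ # 1 ⟩
  g₁′ = ⟨ # 2 ⟩
  g₂′ = ⟨ # 3 ⟩
  c′  = ⟨ # 4 ⟩

module RealRing (ℝ : RealField) where
  open RealField ℝ public

  commutativeRing : CommutativeRing 0ℓ 0ℓ
  commutativeRing = record { isCommutativeRing = isCommutativeRing }

  open CommutativeRing commutativeRing public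
    using ( +-assoc; +-comm; +-identityˡ; +-identityʳ; *-assoc; *-comm; *-identityˡ
          ; distribˡ; distribʳ; zeroˡ; zeroʳ; -‿inverseʳ)
  open RingProperties (CommutativeRing.ring commutativeRing) public
    using (-‿distribˡ-*; -‿+-comm; -0#≈0#; x∙y⁻¹≈ε⇒x≈y; +-cancelˡ)

  open CommutativeSemigroupProperties
    (CommutativeRing.+-commutativeSemigroup commutativeRing) public
    using () renaming (interchange to +-interchange)

module PolynomialDegree (ℝ : RealField) (I : Set) where
  open RealField ℝ using (R; _*_)
  open Polynomials ℝ I
  open ℕₚ.≤-Reasoning

  deg-++ : ∀ p q → deg (p ++ q) ≡ deg p ⊔ deg q
  deg-++ [] q = refl
  deg-++ ((c , m) ∷ p) q =
    trans (cong (length m ⊔_) (deg-++ p q)) (sym (ℕₚ.⊔-assoc (length m) (deg p) (deg q)))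

  -- ((c , m) ∷ p) ⊗ q reduces to scale c m q ++ p ⊗ q.
  scale : R → Monomial → Polynomial → Polynomial
  scale c m = map (λ u → (c * proj₁ u , m ++ proj₂ u))

  private
    deg-scale : ∀ c m q → deg (scale c m q) ≤ℕ length m ℕ.+ deg q
    deg-scale c m [] = z≤n
    deg-scale c m ((d , k) ∷ q) = begin
      length (m ++ k) ⊔ deg (scale c m q)
        ≤⟨ ℕₚ.⊔-mono-≤ (ℕₚ.≤-reflexive (Listₚ.length-++ m)) (deg-scale c m q) ⟩
      (length m ℕ.+ length k) ⊔ (length m ℕ.+ deg q)
        ≡⟨ sym (ℕₚ.+-distribˡ-⊔ (length m) (length k) (deg q)) ⟩
      length m ℕ.+ (length k ⊔ deg q) ∎

    deg-scale-∷ : ∀ c m u q → deg (scale c m (u ∷ q)) ≡ length m ℕ.+ deg (u ∷ q)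
    deg-scale-∷ c m (d , k) [] = begin-equality
      length (m ++ k) ⊔ 0          ≡⟨ ℕₚ.⊔-identityʳ _ ⟩
      length (m ++ k)              ≡⟨ Listₚ.length-++ m ⟩
      length m ℕ.+ length k        ≡⟨ cong (length m ℕ.+_) (sym (ℕₚ.⊔-identityʳ _)) ⟩
      length m ℕ.+ (length k ⊔ 0)  ∎
    deg-scale-∷ c m (d , k) (u ∷ q) = begin-equality
      length (m ++ k) ⊔ deg (scale c m (u ∷ q))
        ≡⟨ cong₂ _⊔_ (Listₚ.length-++ m) (deg-scale-∷ c m u q) ⟩
      (length m ℕ.+ length k) ⊔ (length m ℕ.+ deg (u ∷ q))
        ≡⟨ sym (ℕₚ.+-distribˡ-⊔ (length m) (length k) (deg (u ∷ q))) ⟩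
      length m ℕ.+ (length k ⊔ deg (u ∷ q)) ∎

  deg-⊗ : ∀ p q → deg (p ⊗ q) ≤ℕ deg p ℕ.+ deg q
  deg-⊗ [] q = z≤n
  deg-⊗ ((c , m) ∷ p) q = begin
    deg (scale c m q ++ p ⊗ q)                 ≡⟨ deg-++ (scale c m q) (p ⊗ q) ⟩
    deg (scale c m q) ⊔ deg (p ⊗ q)            ≤⟨ ℕₚ.⊔-mono-≤ (deg-scale c m q) (deg-⊗ p q) ⟩
    (length m ℕ.+ deg q) ⊔ (deg p ℕ.+ deg q)   ≡⟨ sym (ℕₚ.+-distribʳ-⊔ (deg q) (length m) (deg p)) ⟩
    (length m ⊔ deg p) ℕ.+ deg q               ∎

  -- deg is formal (terms never cancel), so the degrees of nonempty factors add.
  deg-⊗-∷ : ∀ t p u q → deg (t ∷ p) ℕ.+ deg (u ∷ q) ≤ℕ deg ((t ∷ p) ⊗ (u ∷ q))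
  deg-⊗-∷ (c , m) [] u q = begin
    (length m ⊔ 0) ℕ.+ deg (u ∷ q)     ≡⟨ cong (ℕ._+ deg (u ∷ q)) (ℕₚ.⊔-identityʳ (length m)) ⟩
    length m ℕ.+ deg (u ∷ q)           ≡⟨ sym (deg-scale-∷ c m u q) ⟩
    deg (scale c m (u ∷ q))            ≤⟨ ℕₚ.m≤m⊔n _ 0 ⟩
    deg (scale c m (u ∷ q)) ⊔ 0        ≡⟨ sym (deg-++ (scale c m (u ∷ q)) []) ⟩
    deg (((c , m) ∷ []) ⊗ (u ∷ q))     ∎
  deg-⊗-∷ (c , m) (t ∷ p) u q = begin
    (length m ⊔ deg (t ∷ p)) ℕ.+ deg (u ∷ q)
      ≡⟨ ℕₚ.+-distribʳ-⊔ (deg (u ∷ q)) (length m) (deg (t ∷ p)) ⟩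
    (length m ℕ.+ deg (u ∷ q)) ⊔ (deg (t ∷ p) ℕ.+ deg (u ∷ q))
      ≤⟨ ℕₚ.⊔-mono-≤ (ℕₚ.≤-reflexive (sym (deg-scale-∷ c m u q))) (deg-⊗-∷ t p u q) ⟩
    deg (scale c m (u ∷ q)) ⊔ deg ((t ∷ p) ⊗ (u ∷ q))
      ≡⟨ sym (deg-++ (scale c m (u ∷ q)) ((t ∷ p) ⊗ (u ∷ q))) ⟩
    deg (((c , m) ∷ t ∷ p) ⊗ (u ∷ q)) ∎

  ∈⇒1≤deg-∑var : ∀ {X : Set} (f : X → I) {x xs} c → x ∈ xs → 1 ≤ℕ deg (∑ (map (var ∘ f) xs) ⊖ c)
  ∈⇒1≤deg-∑var f {xs = y ∷ ys} c _ = ℕₚ.m≤m⊔n 1 (deg (∑ (map (var ∘ f) ys) ⊖ c))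

module PolynomialAlgebra (ℝ : RealField) (I : Set) where
  open RealRing ℝ
  open Polynomials ℝ I
  open PolynomialDegree ℝ I using (scale)

  Valuation : Set
  Valuation = Monomial → R

  Symmetric : Valuation → Set
  Symmetric L = ∀ {m k} → m ↭ k → L m ≡ L k

  -- Agrees definitionally with Functional.𝔼 of a functional whose values on monomials are L.
  ⟦_⟧ : Polynomial → Valuation → R
  ⟦ p ⟧ L = foldr (λ t s → proj₁ t * L (proj₂ t) + s) 0r p

  ⟦⟧-++ : ∀ p q L → ⟦ p ++ q ⟧ L ≡ ⟦ p ⟧ L + ⟦ q ⟧ L
  ⟦⟧-++ [] q L = sym (+-identityˡ _)
  ⟦⟧-++ (t ∷ p) q L = trans (cong (_ +_) (⟦⟧-++ p q L)) (sym (+-assoc _ _ _))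

  ⟦⟧-⊝ : ∀ p L → ⟦ ⊝ p ⟧ L ≡ - ⟦ p ⟧ L
  ⟦⟧-⊝ [] L = sym -0#≈0#
  ⟦⟧-⊝ ((c , m) ∷ p) L =
    trans (cong₂ _+_ (sym (-‿distribˡ-* c (L m))) (⟦⟧-⊝ p L)) (-‿+-comm _ _)

  ⟦⟧-cong : ∀ p {F G : Valuation} → (∀ m → F m ≡ G m) → ⟦ p ⟧ F ≡ ⟦ p ⟧ G
  ⟦⟧-cong [] F≗G = refl
  ⟦⟧-cong ((c , m) ∷ p) F≗G = cong₂ _+_ (cong (c *_) (F≗G m)) (⟦⟧-cong p F≗G)

  ⟦⟧-zero : ∀ p → ⟦ p ⟧ (λ _ → 0r) ≡ 0r
  ⟦⟧-zero [] = refl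
  ⟦⟧-zero ((c , m) ∷ p) = trans (cong₂ _+_ (zeroʳ c) (⟦⟧-zero p)) (+-identityʳ 0r)

  ⟦⟧-+ : ∀ p (F G : Valuation) → ⟦ p ⟧ (λ m → F m + G m) ≡ ⟦ p ⟧ F + ⟦ p ⟧ G
  ⟦⟧-+ [] F G = sym (+-identityˡ _)
  ⟦⟧-+ ((c , m) ∷ p) F G =
    trans (cong₂ _+_ (distribˡ c (F m) (G m)) (⟦⟧-+ p F G)) (+-interchange _ _ _ _)

  ⟦⟧-* : ∀ p c (F : Valuation) → ⟦ p ⟧ (λ m → c * F m) ≡ c * ⟦ p ⟧ F
  ⟦⟧-* [] c F = sym (zeroʳ c)
  ⟦⟧-* ((d , m) ∷ p) c F =
    trans (cong₂ _+_ (x*[y*z]≡y*[x*z] d c (F m)) (⟦⟧-* p c F)) (sym (distribˡ c _ _))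
    where
    x*[y*z]≡y*[x*z] : ∀ x y z → x * (y * z) ≡ y * (x * z)
    x*[y*z]≡y*[x*z] x y z =
      trans (sym (*-assoc x y z)) (trans (cong (_* z) (*-comm x y)) (*-assoc y x z))

  ⟦⟧-swap : ∀ p q (F : Monomial → Monomial → R) →
    ⟦ p ⟧ (λ m → ⟦ q ⟧ (F m)) ≡ ⟦ q ⟧ (λ k → ⟦ p ⟧ (λ m → F m k))
  ⟦⟧-swap [] q F = sym (⟦⟧-zero q)
  ⟦⟧-swap ((c , m) ∷ p) q F = begin
    c * ⟦ q ⟧ (F m) + ⟦ p ⟧ (λ m′ → ⟦ q ⟧ (F m′))
      ≡⟨ cong₂ _+_ (sym (⟦⟧-* q c (F m))) (⟦⟧-swap p q F) ⟩
    ⟦ q ⟧ (λ k → c * F m k) + ⟦ q ⟧ (λ k → ⟦ p ⟧ (λ m′ → F m′ k))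
      ≡⟨ sym (⟦⟧-+ q _ _) ⟩
    ⟦ q ⟧ (λ k → c * F m k + ⟦ p ⟧ (λ m′ → F m′ k)) ∎
    where open ≡-Reasoning

  ⟦⟧-⊗ : ∀ p q L → ⟦ p ⊗ q ⟧ L ≡ ⟦ p ⟧ (λ m → ⟦ q ⟧ (λ k → L (m ++ k)))
  ⟦⟧-⊗ [] q L = refl
  ⟦⟧-⊗ ((c , m) ∷ p) q L = begin
    ⟦ scale c m q ++ p ⊗ q ⟧ L                   ≡⟨ ⟦⟧-++ (scale c m q) (p ⊗ q) L ⟩
    ⟦ scale c m q ⟧ L + ⟦ p ⊗ q ⟧ L              ≡⟨ cong₂ _+_ (⟦⟧-scale q) (⟦⟧-⊗ p q L) ⟩
    c * ⟦ q ⟧ (λ k → L (m ++ k)) + ⟦ p ⟧ (λ m′ → ⟦ q ⟧ (λ k → L (m′ ++ k))) ∎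
    where
    open ≡-Reasoning
    ⟦⟧-scale : ∀ q → ⟦ scale c m q ⟧ L ≡ c * ⟦ q ⟧ (λ k → L (m ++ k))
    ⟦⟧-scale []            = sym (zeroʳ c)
    ⟦⟧-scale ((d , k) ∷ q) = trans (cong₂ _+_ (*-assoc c d _) (⟦⟧-scale q)) (sym (distribˡ c _ _))

  ⟦⟧-const⊗ : ∀ c p L → ⟦ const c ⊗ p ⟧ L ≡ c * ⟦ p ⟧ L
  ⟦⟧-const⊗ c p L = trans (⟦⟧-⊗ (const c) p L) (+-identityʳ _)

  ⟦⟧-⊖⊗ : ∀ g h q L → ⟦ (g ⊖ h) ⊗ q ⟧ L ≡ ⟦ g ⊗ q ⟧ L + - ⟦ h ⊗ q ⟧ L
  ⟦⟧-⊖⊗ g h q L = begin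
    ⟦ (g ⊖ h) ⊗ q ⟧ L                    ≡⟨ ⟦⟧-⊗ (g ⊖ h) q L ⟩
    ⟦ g ⊖ h ⟧ Q                          ≡⟨ ⟦⟧-++ g (⊝ h) Q ⟩
    ⟦ g ⟧ Q + ⟦ ⊝ h ⟧ Q                  ≡⟨ cong (⟦ g ⟧ Q +_) (⟦⟧-⊝ h Q) ⟩
    ⟦ g ⟧ Q + - ⟦ h ⟧ Q                  ≡⟨ sym (cong₂ (λ x y → x + - y) (⟦⟧-⊗ g q L) (⟦⟧-⊗ h q L)) ⟩
    ⟦ g ⊗ q ⟧ L + - ⟦ h ⊗ q ⟧ L ∎
    where
    open ≡-Reasoning
    Q : Valuation
    Q m = ⟦ q ⟧ (λ k → L (m ++ k))

  infix 4 _≈_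
  record _≈_ (p q : Polynomial) : Set where
    constructor mk≈
    field at : ∀ L → Symmetric L → ⟦ p ⟧ L ≡ ⟦ q ⟧ L
  open _≈_ public

  ≈-refl : ∀ {p} → p ≈ p
  ≈-refl = mk≈ λ _ _ → refl

  ≈-sym : ∀ {p q} → p ≈ q → q ≈ p
  ≈-sym p≈q = mk≈ λ L s → sym (at p≈q L s)

  ≈-trans : ∀ {p q t} → p ≈ q → q ≈ t → p ≈ t
  ≈-trans p≈q q≈t = mk≈ λ L s → trans (at p≈q L s) (at q≈t L s)

  ≡⇒≈ : ∀ {p q} → p ≡ q → p ≈ q
  ≡⇒≈ refl = ≈-refl

  ≈-setoid : Setoid 0ℓ 0ℓ
  ≈-setoid = record
    { Carrier = Polynomial ; _≈_ = _≈_
    ; isEquivalence = record { refl = ≈-refl ; sym = ≈-sym ; trans = ≈-trans } }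

  ⊕-cong : ∀ {p p′ q q′} → p ≈ p′ → q ≈ q′ → p ⊕ q ≈ p′ ⊕ q′
  ⊕-cong {p} {p′} {q} {q′} p≈p′ q≈q′ = mk≈ λ L s → begin
    ⟦ p ⊕ q ⟧ L           ≡⟨ ⟦⟧-++ p q L ⟩
    ⟦ p ⟧ L + ⟦ q ⟧ L     ≡⟨ cong₂ _+_ (at p≈p′ L s) (at q≈q′ L s) ⟩
    ⟦ p′ ⟧ L + ⟦ q′ ⟧ L   ≡⟨ sym (⟦⟧-++ p′ q′ L) ⟩
    ⟦ p′ ⊕ q′ ⟧ L         ∎
    where open ≡-Reasoning

  ⊕-comm : ∀ p q → p ⊕ q ≈ q ⊕ p
  ⊕-comm p q = mk≈ λ L s → trans (⟦⟧-++ p q L) (trans (+-comm _ _) (sym (⟦⟧-++ q p L)))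

  ⊕-assoc : ∀ p q t → (p ⊕ q) ⊕ t ≈ p ⊕ (q ⊕ t)
  ⊕-assoc p q t = ≡⇒≈ (Listₚ.++-assoc p q t)

  ⊕-identityʳ : ∀ p → p ⊕ [] ≈ p
  ⊕-identityʳ p = ≡⇒≈ (Listₚ.++-identityʳ p)

  ⊕-commutativeMonoid : CommutativeMonoid 0ℓ 0ℓ
  ⊕-commutativeMonoid = record
    { Carrier = Polynomial ; _≈_ = _≈_ ; _∙_ = _⊕_ ; ε = []
    ; isCommutativeMonoid = record
      { isMonoid = record
        { isSemigroup = record
          { isMagma = record
            { isEquivalence = Setoid.isEquivalence ≈-setoid ; ∙-cong = ⊕-cong }
          ; assoc = ⊕-assoc }
        ; identity = (λ _ → ≈-refl) , ⊕-identityʳ }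
      ; comm = ⊕-comm } }

  ⊗-congʳ : ∀ p {q q′} → q ≈ q′ → p ⊗ q ≈ p ⊗ q′
  ⊗-congʳ p {q} {q′} q≈q′ = mk≈ λ L s → begin
    ⟦ p ⊗ q ⟧ L                                 ≡⟨ ⟦⟧-⊗ p q L ⟩
    ⟦ p ⟧ (λ m → ⟦ q ⟧ (λ k → L (m ++ k)))      ≡⟨ ⟦⟧-cong p (λ m → at q≈q′ _ (s ∘ ↭ₚ.++⁺ˡ m)) ⟩
    ⟦ p ⟧ (λ m → ⟦ q′ ⟧ (λ k → L (m ++ k)))     ≡⟨ sym (⟦⟧-⊗ p q′ L) ⟩
    ⟦ p ⊗ q′ ⟧ L                                ∎
    where open ≡-Reasoning

  ⊗-comm : ∀ p q → p ⊗ q ≈ q ⊗ p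
  ⊗-comm p q = mk≈ λ L s → begin
    ⟦ p ⊗ q ⟧ L                                 ≡⟨ ⟦⟧-⊗ p q L ⟩
    ⟦ p ⟧ (λ m → ⟦ q ⟧ (λ k → L (m ++ k)))      ≡⟨ ⟦⟧-swap p q _ ⟩
    ⟦ q ⟧ (λ k → ⟦ p ⟧ (λ m → L (m ++ k)))
      ≡⟨ ⟦⟧-cong q (λ k → ⟦⟧-cong p (λ m → s (↭ₚ.++-comm m k))) ⟩
    ⟦ q ⟧ (λ k → ⟦ p ⟧ (λ m → L (k ++ m)))      ≡⟨ sym (⟦⟧-⊗ q p L) ⟩
    ⟦ q ⊗ p ⟧ L                                 ∎
    where open ≡-Reasoning

  ⊗-congˡ : ∀ {p p′} q → p ≈ p′ → p ⊗ q ≈ p′ ⊗ q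
  ⊗-congˡ {p} {p′} q p≈p′ = ≈-trans (⊗-comm p q) (≈-trans (⊗-congʳ q p≈p′) (⊗-comm q p′))

  ⊗-cong : ∀ {p p′ q q′} → p ≈ p′ → q ≈ q′ → p ⊗ q ≈ p′ ⊗ q′
  ⊗-cong {p′ = p′} {q = q} p≈p′ q≈q′ = ≈-trans (⊗-congˡ q p≈p′) (⊗-congʳ p′ q≈q′)

  ⊗-assoc : ∀ p q t → (p ⊗ q) ⊗ t ≈ p ⊗ (q ⊗ t)
  ⊗-assoc p q t = mk≈ λ L s → begin
    ⟦ (p ⊗ q) ⊗ t ⟧ L                           ≡⟨ ⟦⟧-⊗ (p ⊗ q) t L ⟩
    ⟦ p ⊗ q ⟧ (λ w → ⟦ t ⟧ (λ j → L (w ++ j)))  ≡⟨ ⟦⟧-⊗ p q _ ⟩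
    ⟦ p ⟧ (λ m → ⟦ q ⟧ (λ k → ⟦ t ⟧ (λ j → L ((m ++ k) ++ j))))
      ≡⟨ ⟦⟧-cong p (λ m → ⟦⟧-cong q (λ k → ⟦⟧-cong t (λ j → cong L (Listₚ.++-assoc m k j)))) ⟩
    ⟦ p ⟧ (λ m → ⟦ q ⟧ (λ k → ⟦ t ⟧ (λ j → L (m ++ (k ++ j)))))
      ≡⟨ ⟦⟧-cong p (λ m → sym (⟦⟧-⊗ q t _)) ⟩
    ⟦ p ⟧ (λ m → ⟦ q ⊗ t ⟧ (λ w → L (m ++ w)))  ≡⟨ sym (⟦⟧-⊗ p (q ⊗ t) L) ⟩
    ⟦ p ⊗ (q ⊗ t) ⟧ L                           ∎
    where open ≡-Reasoning

  ⊗-distribʳ : ∀ p q t → (p ⊕ q) ⊗ t ≈ p ⊗ t ⊕ q ⊗ t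
  ⊗-distribʳ p q t = mk≈ λ L _ → begin
    ⟦ (p ⊕ q) ⊗ t ⟧ L                           ≡⟨ ⟦⟧-⊗ (p ⊕ q) t L ⟩
    ⟦ p ⊕ q ⟧ (T L)                             ≡⟨ ⟦⟧-++ p q (T L) ⟩
    ⟦ p ⟧ (T L) + ⟦ q ⟧ (T L)                   ≡⟨ sym (cong₂ _+_ (⟦⟧-⊗ p t L) (⟦⟧-⊗ q t L)) ⟩
    ⟦ p ⊗ t ⟧ L + ⟦ q ⊗ t ⟧ L                   ≡⟨ sym (⟦⟧-++ (p ⊗ t) (q ⊗ t) L) ⟩
    ⟦ p ⊗ t ⊕ q ⊗ t ⟧ L                         ∎
    where
    open ≡-Reasoning
    T : Valuation → Valuation
    T L m = ⟦ t ⟧ (λ k → L (m ++ k))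

  ⊗-zeroʳ : ∀ p → p ⊗ [] ≈ []
  ⊗-zeroʳ p = mk≈ λ L s → trans (⟦⟧-⊗ p [] L) (⟦⟧-zero p)

  ⊗-identityˡ : ∀ p → const 1r ⊗ p ≈ p
  ⊗-identityˡ p = mk≈ λ L s → trans (⟦⟧-const⊗ 1r p L) (*-identityˡ _)

  ⊗-identityʳ : ∀ p → p ⊗ const 1r ≈ p
  ⊗-identityʳ p = ≈-trans (⊗-comm p (const 1r)) (⊗-identityˡ p)

  ⊗-distribˡ : ∀ p q t → p ⊗ (q ⊕ t) ≈ p ⊗ q ⊕ p ⊗ t
  ⊗-distribˡ p q t = ≈-trans (⊗-comm p (q ⊕ t))
    (≈-trans (⊗-distribʳ q t p) (⊕-cong (⊗-comm q p) (⊗-comm t p)))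

  ⊗-interchange : ∀ a b c d → (a ⊗ b) ⊗ (c ⊗ d) ≈ (a ⊗ c) ⊗ (b ⊗ d)
  ⊗-interchange a b c d = begin
    (a ⊗ b) ⊗ (c ⊗ d)  ≈⟨ ⊗-assoc a b (c ⊗ d) ⟩
    a ⊗ (b ⊗ (c ⊗ d))  ≈⟨ ⊗-congʳ a (≈-sym (⊗-assoc b c d)) ⟩
    a ⊗ ((b ⊗ c) ⊗ d)  ≈⟨ ⊗-congʳ a (⊗-congˡ d (⊗-comm b c)) ⟩
    a ⊗ ((c ⊗ b) ⊗ d)  ≈⟨ ⊗-congʳ a (⊗-assoc c b d) ⟩
    a ⊗ (c ⊗ (b ⊗ d))  ≈⟨ ≈-sym (⊗-assoc a c (b ⊗ d)) ⟩
    (a ⊗ c) ⊗ (b ⊗ d)  ∎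
    where open SetoidReasoning ≈-setoid

  when : {P : Set} → Dec P → Polynomial → Polynomial
  when (yes _) p = p
  when (no _)  _ = []

  when-yes : {P : Set} (P? : Dec P) {p : Polynomial} → P → when P? p ≈ p
  when-yes (yes _) _  = ≈-refl
  when-yes (no ¬P) pf = ⊥-elim (¬P pf)

  when-no : {P : Set} (P? : Dec P) {p : Polynomial} → ¬ P → when P? p ≈ []
  when-no (yes pf) ¬P = ⊥-elim (¬P pf)
  when-no (no _)   _  = ≈-refl

  deg-when : {P : Set} (P? : Dec P) (p : Polynomial) → deg (when P? p) ≤ℕ deg p
  deg-when (yes _) p = ℕₚ.≤-refl
  deg-when (no _)  p = z≤n

  ∑-++ : {X : Set} (f : X → Polynomial) (xs ys : List X) →
    ∑ (map f (xs ++ ys)) ≈ ∑ (map f xs) ⊕ ∑ (map f ys)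
  ∑-++ f [] ys = ≈-refl
  ∑-++ f (x ∷ xs) ys =
    ≈-trans (⊕-cong (≈-refl {f x}) (∑-++ f xs ys)) (≈-sym (⊕-assoc (f x) _ _))

  ∑-map : {X Y : Set} (f : Y → Polynomial) (g : X → Y) (xs : List X) →
    ∑ (map f (map g xs)) ≈ ∑ (map (f ∘ g) xs)
  ∑-map f g xs = ≡⇒≈ (cong ∑ (sym (Listₚ.map-∘ xs)))

  ∑-concatMap : {X Y : Set} (f : Y → Polynomial) (g : X → List Y) (xs : List X) →
    ∑ (map f (concatMap g xs)) ≈ ∑ (map (λ x → ∑ (map f (g x))) xs)
  ∑-concatMap f g [] = ≈-refl
  ∑-concatMap f g (x ∷ xs) =
    ≈-trans (∑-++ f (g x) (concatMap g xs)) (⊕-cong ≈-refl (∑-concatMap f g xs))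

  ∑-cong : {X : Set} {f g : X → Polynomial} (xs : List X) → (∀ x → f x ≈ g x) →
    ∑ (map f xs) ≈ ∑ (map g xs)
  ∑-cong [] f≈g = ≈-refl
  ∑-cong (x ∷ xs) f≈g = ⊕-cong (f≈g x) (∑-cong xs f≈g)

  ∑-zero : {X : Set} {f : X → Polynomial} (xs : List X) → (∀ x → f x ≈ []) → ∑ (map f xs) ≈ []
  ∑-zero [] _ = ≈-refl
  ∑-zero (x ∷ xs) f≈[] = ⊕-cong (f≈[] x) (∑-zero xs f≈[])

  ∑-allFin-single : ∀ {k} (f : Fin k → Polynomial) y → (∀ z → y ≢ z → f z ≈ []) →
    ∑ (map f (allFin k)) ≈ f y
  ∑-allFin-single {k} f y off = ≈-trans (≡⇒≈ (cong ∑ (Listₚ.map-tabulate id f))) (single k f y off)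
    where
    single : ∀ k (f : Fin k → Polynomial) y → (∀ z → y ≢ z → f z ≈ []) → ∑ (tabulate f) ≈ f y
    single (suc k) f Fin.zero off =
      ≈-trans (⊕-cong ≈-refl (≈-trans (≡⇒≈ (cong ∑ (sym (Listₚ.map-tabulate id (f ∘ Fin.suc)))))
                                       (∑-zero (allFin k) (λ z → off (Fin.suc z) λ ()))))
              (⊕-identityʳ (f Fin.zero))
    single (suc k) f (Fin.suc y) off =
      ⊕-cong (off Fin.zero λ ())
             (single k (f ∘ Fin.suc) y (λ z y≢z → off (Fin.suc z) (y≢z ∘ Finₚ.suc-injective)))

  ∑-distribˡ : {X : Set} (p : Polynomial) (g : X → Polynomial) (xs : List X) →
    ∑ (map (λ x → p ⊗ g x) xs) ≈ p ⊗ ∑ (map g xs)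
  ∑-distribˡ p g []       = ≈-sym (⊗-zeroʳ p)
  ∑-distribˡ p g (x ∷ xs) =
    ≈-trans (⊕-cong ≈-refl (∑-distribˡ p g xs)) (≈-sym (⊗-distribˡ p (g x) (∑ (map g xs))))

  ∑-allFin-diagonalˡ : ∀ {k} (x : Fin k) (F : (y : Fin k) → Dec (x ≡ y) → Polynomial) →
    (∀ y x≢y → F y (no x≢y) ≈ []) → ∑ (map (λ y → F y (x Fin.≟ y)) (allFin k)) ≈ F x (yes refl)
  ∑-allFin-diagonalˡ x F off = ≈-trans
    (∑-allFin-single (λ y → F y (x Fin.≟ y)) x
      (λ y x≢y → subst (λ d → F y d ≈ []) (sym (≢-≟-identity Fin._≟_ x≢y)) (off y x≢y)))
    (≡⇒≈ (cong (F x) (≡-≟-identity Fin._≟_ refl)))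

  ∑-allFin-diagonalʳ : ∀ {k} (x : Fin k) (F : (y : Fin k) → Dec (y ≡ x) → Polynomial) →
    (∀ y y≢x → F y (no y≢x) ≈ []) → ∑ (map (λ y → F y (y Fin.≟ x)) (allFin k)) ≈ F x (yes refl)
  ∑-allFin-diagonalʳ x F off = ≈-trans
    (∑-allFin-single (λ y → F y (y Fin.≟ x)) x
      (λ y x≢y → subst (λ d → F y d ≈ []) (sym (≢-≟-identity Fin._≟_ (x≢y ∘ sym))) (off y (x≢y ∘ sym))))
    (≡⇒≈ (cong (F x) (≡-≟-identity Fin._≟_ refl)))

  module LabelSums where
    open CommutativeMonoidSolver ⊕-commutativeMonoid public using (prove)
    open CommutativeMonoidSolver ⊕-commutativeMonoid
      using (Expr) renaming (var to ⟨_⟩; id to ∅; _⊕_ to _⊹_)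

    -- Has the shape of ∑ over a four-element list, so that it unifies with ∑ (map f labels).
    summands : Fin 4 → Fin 4 → Fin 4 → Fin 4 → Expr 4
    summands a b c d = ⟨ a ⟩ ⊹ (⟨ b ⟩ ⊹ (⟨ c ⟩ ⊹ (⟨ d ⟩ ⊹ ∅)))

    in-order : Expr 4
    in-order = summands (# 0) (# 1) (# 2) (# 3)

    values : (Bool × Bool → Polynomial) → Vec Polynomial 4
    values f = f (false , false) ∷ᵥ f (false , true) ∷ᵥ f (true , false) ∷ᵥ f (true , true) ∷ᵥ []ᵥ

  ∑-labels-translate : ∀ (f : Bool × Bool → Polynomial) α →
    ∑ (map (λ γ → f (α ⊞ γ)) labels) ≈ ∑ (map f labels)
  ∑-labels-translate f (false , false) = ≈-refl
  ∑-labels-translate f (false , true)  = prove 4 (summands (# 1) (# 0) (# 3) (# 2)) in-order (values f)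
    where open LabelSums
  ∑-labels-translate f (true , false)  = prove 4 (summands (# 2) (# 3) (# 0) (# 1)) in-order (values f)
    where open LabelSums
  ∑-labels-translate f (true , true)   = prove 4 (summands (# 3) (# 2) (# 1) (# 0)) in-order (values f)
    where open LabelSums

  ∑-labels-translateʳ : ∀ (f : Bool × Bool → Polynomial) α →
    ∑ (map (λ γ → f (γ ⊞ α)) labels) ≈ ∑ (map f labels)
  ∑-labels-translateʳ f α =
    ≈-trans (∑-cong labels (λ γ → ≡⇒≈ (cong f (⊞-comm γ α)))) (∑-labels-translate f α)

  const-0 : [] ≈ const 0r
  const-0 = mk≈ λ L _ → sym (trans (+-identityʳ _) (zeroˡ _))

  const-+ : ∀ a b → const a ⊕ const b ≈ const (a + b)
  const-+ a b = mk≈ λ L _ →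
    trans (cong (a * L [] +_) (+-identityʳ _)) (sym (trans (+-identityʳ _) (distribʳ (L []) a b)))

  annihilates⇒nonNegOn : ∀ E r g → Annihilates E r g → NonNegOn E r g
  annihilates⇒nonNegOn E r g ann p le =
    subst (0r ≤_) (sym (ann (p ⊗ p) le)) (IsTotalOrder.refl isTotalOrder)

module Congruence (ℝ : RealField) (I : Set) (E : Polynomials.Functional ℝ I) (r : ℕ) where
  open RealRing ℝ
  open Polynomials ℝ I
  open PolynomialAlgebra ℝ I
  open PolynomialDegree ℝ I
  open Functional E using (L; L-sym)

  infix 4 _≡[_]_
  record _≡[_]_ (g : Polynomial) (d : ℕ) (h : Polynomial) : Set where
    constructor mk≡
    field agree : ∀ q → d ℕ.+ deg q ≤ℕ r → ⟦ g ⊗ q ⟧ L ≡ ⟦ h ⊗ q ⟧ L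
  open _≡[_]_ public

  ≈⇒≡[] : ∀ {d g h} → g ≈ h → g ≡[ d ] h
  ≈⇒≡[] {g = g} {h} g≈h = mk≡ λ q _ → at (⊗-congˡ q g≈h) L L-sym

  ≡[]-sym : ∀ {d g h} → g ≡[ d ] h → h ≡[ d ] g
  ≡[]-sym g≡h = mk≡ λ q le → sym (agree g≡h q le)

  ≡[]-trans : ∀ {d g h k} → g ≡[ d ] h → h ≡[ d ] k → g ≡[ d ] k
  ≡[]-trans g≡h h≡k = mk≡ λ q le → trans (agree g≡h q le) (agree h≡k q le)

  ≡[]-setoid : ℕ → Setoid 0ℓ 0ℓ
  ≡[]-setoid d = record
    { Carrier = Polynomial ; _≈_ = _≡[ d ]_
    ; isEquivalence = record { refl = ≈⇒≡[] ≈-refl ; sym = ≡[]-sym ; trans = ≡[]-trans } }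

  ≡[]-mono : ∀ {d d′ g h} → d ≤ℕ d′ → g ≡[ d ] h → g ≡[ d′ ] h
  ≡[]-mono d≤d′ g≡h = mk≡ λ q le → agree g≡h q (ℕₚ.≤-trans (ℕₚ.+-monoˡ-≤ _ d≤d′) le)

  ⊕-cong≡ : ∀ {d g g′ h h′} → g ≡[ d ] g′ → h ≡[ d ] h′ → g ⊕ h ≡[ d ] g′ ⊕ h′
  ⊕-cong≡ {g = g} {g′} {h} {h′} g≡g′ h≡h′ = mk≡ λ q le → begin
    ⟦ (g ⊕ h) ⊗ q ⟧ L               ≡⟨ at (⊗-distribʳ g h q) L L-sym ⟩
    ⟦ g ⊗ q ⊕ h ⊗ q ⟧ L             ≡⟨ ⟦⟧-++ (g ⊗ q) (h ⊗ q) L ⟩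
    ⟦ g ⊗ q ⟧ L + ⟦ h ⊗ q ⟧ L       ≡⟨ cong₂ _+_ (agree g≡g′ q le) (agree h≡h′ q le) ⟩
    ⟦ g′ ⊗ q ⟧ L + ⟦ h′ ⊗ q ⟧ L     ≡⟨ sym (⟦⟧-++ (g′ ⊗ q) (h′ ⊗ q) L) ⟩
    ⟦ g′ ⊗ q ⊕ h′ ⊗ q ⟧ L           ≡⟨ sym (at (⊗-distribʳ g′ h′ q) L L-sym) ⟩
    ⟦ (g′ ⊕ h′) ⊗ q ⟧ L             ∎
    where open ≡-Reasoning

  ⊕-cancelˡ≡ : ∀ {d} p {g h} → p ⊕ g ≡[ d ] p ⊕ h → g ≡[ d ] h
  ⊕-cancelˡ≡ p {g} {h} p⊕g≡p⊕h = mk≡ λ q le → +-cancelˡ (⟦ p ⊗ q ⟧ L) _ _ (begin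
    ⟦ p ⊗ q ⟧ L + ⟦ g ⊗ q ⟧ L     ≡⟨ sym (⟦⟧-++ (p ⊗ q) (g ⊗ q) L) ⟩
    ⟦ p ⊗ q ⊕ g ⊗ q ⟧ L           ≡⟨ sym (at (⊗-distribʳ p g q) L L-sym) ⟩
    ⟦ (p ⊕ g) ⊗ q ⟧ L             ≡⟨ agree p⊕g≡p⊕h q le ⟩
    ⟦ (p ⊕ h) ⊗ q ⟧ L             ≡⟨ at (⊗-distribʳ p h q) L L-sym ⟩
    ⟦ p ⊗ q ⊕ h ⊗ q ⟧ L           ≡⟨ ⟦⟧-++ (p ⊗ q) (h ⊗ q) L ⟩
    ⟦ p ⊗ q ⟧ L + ⟦ h ⊗ q ⟧ L     ∎)
    where open ≡-Reasoning

  ⊗-cong≡ˡ : ∀ {d e g g′} h → g ≡[ d ] g′ → deg h ≤ℕ e → g ⊗ h ≡[ d ℕ.+ e ] g′ ⊗ h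
  ⊗-cong≡ˡ {d} {e} {g} {g′} h g≡g′ deg-h≤e = mk≡ λ q le → begin
    ⟦ (g ⊗ h) ⊗ q ⟧ L      ≡⟨ at (⊗-assoc g h q) L L-sym ⟩
    ⟦ g ⊗ (h ⊗ q) ⟧ L      ≡⟨ agree g≡g′ (h ⊗ q) (bound q le) ⟩
    ⟦ g′ ⊗ (h ⊗ q) ⟧ L     ≡⟨ sym (at (⊗-assoc g′ h q) L L-sym) ⟩
    ⟦ (g′ ⊗ h) ⊗ q ⟧ L     ∎
    where
    open ≡-Reasoning
    bound : ∀ q → d ℕ.+ e ℕ.+ deg q ≤ℕ r → d ℕ.+ deg (h ⊗ q) ≤ℕ r
    bound q le = ℕₚ.≤-trans
      (ℕₚ.+-monoʳ-≤ d (ℕₚ.≤-trans (deg-⊗ h q) (ℕₚ.+-monoˡ-≤ (deg q) deg-h≤e)))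
      (ℕₚ.≤-trans (ℕₚ.≤-reflexive (sym (ℕₚ.+-assoc d e (deg q)))) le)

  ⊗-cong≡ʳ : ∀ {d e g g′} h → g ≡[ d ] g′ → deg h ≤ℕ e → h ⊗ g ≡[ d ℕ.+ e ] h ⊗ g′
  ⊗-cong≡ʳ {g = g} {g′} h g≡g′ deg-h≤e = ≡[]-trans (≈⇒≡[] (⊗-comm h g))
    (≡[]-trans (⊗-cong≡ˡ h g≡g′ deg-h≤e) (≈⇒≡[] (⊗-comm g′ h)))

  annihilates⇒≡[] : ∀ g h → Annihilates E r (g ⊖ h) → g ≡[ deg (g ⊖ h) ] h
  annihilates⇒≡[] g h ann = mk≡ λ q le → x∙y⁻¹≈ε⇒x≈y _ _ (begin
    ⟦ g ⊗ q ⟧ L + - ⟦ h ⊗ q ⟧ L   ≡⟨ sym (⟦⟧-⊖⊗ g h q L) ⟩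
    ⟦ (g ⊖ h) ⊗ q ⟧ L             ≡⟨ ann q (ℕₚ.≤-trans (deg-⊗ (g ⊖ h) q) le) ⟩
    0r                            ∎)
    where open ≡-Reasoning

  ∑-cong≡ : ∀ {d} {X : Set} {f g : X → Polynomial} (xs : List X) → (∀ x → f x ≡[ d ] g x) →
    ∑ (map f xs) ≡[ d ] ∑ (map g xs)
  ∑-cong≡ [] f≡g = ≈⇒≡[] ≈-refl
  ∑-cong≡ (x ∷ xs) f≡g = ⊕-cong≡ (f≡g x) (∑-cong≡ xs f≡g)

  ∑-ones≡ : ∀ {d} {X : Set} {f : X → Polynomial} (xs : List X) → All (λ x → f x ≡[ d ] const 1r) xs →
    ∑ (map f xs) ≡[ d ] const (fromℕ (length xs))
  ∑-ones≡ [] [] = ≈⇒≡[] const-0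
  ∑-ones≡ (x ∷ xs) (fx≡1 ∷ rest) =
    ≡[]-trans (⊕-cong≡ fx≡1 (∑-ones≡ xs rest)) (≈⇒≡[] (const-+ 1r (fromℕ (length xs))))

  ≡[]⇒annihilated : ∀ {d g h} → g ≡[ d ] h → ∀ q → d ℕ.+ deg q ≤ℕ r → ⟦ (g ⊖ h) ⊗ q ⟧ L ≡ 0r
  ≡[]⇒annihilated {g = g} {h} g≡h q le = begin
    ⟦ (g ⊖ h) ⊗ q ⟧ L             ≡⟨ ⟦⟧-⊖⊗ g h q L ⟩
    ⟦ g ⊗ q ⟧ L + - ⟦ h ⊗ q ⟧ L   ≡⟨ cong (_+ - ⟦ h ⊗ q ⟧ L) (agree g≡h q le) ⟩
    ⟦ h ⊗ q ⟧ L + - ⟦ h ⊗ q ⟧ L   ≡⟨ -‿inverseʳ _ ⟩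
    0r                            ∎
    where open ≡-Reasoning

  ⊗-orthogonal : ∀ {d e} p q p′ q′ → p ⊗ p′ ≡[ d ] [] → deg (q ⊗ q′) ≤ℕ e →
    (p ⊗ q) ⊗ (p′ ⊗ q′) ≡[ d ℕ.+ e ] []
  ⊗-orthogonal p q p′ q′ pp′≡0 deg≤e =
    ≡[]-trans (≈⇒≡[] (⊗-interchange p q p′ q′)) (⊗-cong≡ˡ (q ⊗ q′) pp′≡0 deg≤e)

  ⊗-absorbs : ∀ {d e} p q → p ⊗ p ≡[ d ] p → deg q ≤ℕ e → (p ⊗ q) ⊗ p ≡[ d ℕ.+ e ] p ⊗ q
  ⊗-absorbs p q pp≡p deg-q≤e = ≡[]-trans (≈⇒≡[] rearrange) (⊗-cong≡ˡ q pp≡p deg-q≤e)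
    where
    rearrange : (p ⊗ q) ⊗ p ≈ (p ⊗ p) ⊗ q
    rearrange = ≈-trans (⊗-assoc p q p) (≈-trans (⊗-congʳ p (⊗-comm q p)) (≈-sym (⊗-assoc p p q)))

module XORAxioms (ℝ : RealField) {n m : ℕ} (C : Instance n m) (r : ℕ)
                 (PE : PseudoExpectation3XOR ℝ C r) where
  open RealRing ℝ
  open Polynomials ℝ (Fin n × Bool)
  open PolynomialAlgebra ℝ (Fin n × Bool)
  open PseudoExpectation3XOR PE
  open Congruence ℝ (Fin n × Bool) E r public

  A : Fin n → Bool → Polynomial
  A x a = var (x , a)

  x₁ x₂ x₃ : Fin m → Fin n
  x₁ i = XORConstraint.x₁ (C i)
  x₂ i = XORConstraint.x₂ (C i)
  x₃ i = XORConstraint.x₃ (C i)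

  -- The indicator of the i-th constraint's variables taking the satisfying assignment indexed by α.
  ℓ₁ ℓ₂ ℓ₃ χ : Fin m → Bool × Bool → Polynomial
  ℓ₁ i (a₁ , a₂) = A (x₁ i) a₁
  ℓ₂ i (a₁ , a₂) = A (x₂ i) a₂
  ℓ₃ i (a₁ , a₂) = A (x₃ i) (third (C i) a₁ a₂)
  χ i α = ℓ₁ i α ⊗ ℓ₂ i α ⊗ ℓ₃ i α

  A-idempotent : ∀ x a → A x a ⊗ A x a ≡[ 2 ] A x a
  A-idempotent x a = annihilates⇒≡[] _ _ (booleanity x a)

  A-complement : ∀ x a → A x a ⊕ A x (not a) ≡[ 1 ] const 1r
  A-complement x false = annihilates⇒≡[] _ _ (one-value x)
  A-complement x true  = ≡[]-trans (≈⇒≡[] (⊕-comm (A x true) (A x false))) (A-complement x false)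

  ∑-χ : ∀ i → ∑ (map (χ i) labels) ≡[ 3 ] const 1r
  ∑-χ i = annihilates⇒≡[] _ _ (constraints i)

  -- Multiply the complement axiom by A x a and cancel A x a using booleanity.
  A-orthogonal-not : ∀ x a → A x a ⊗ A x (not a) ≡[ 2 ] []
  A-orthogonal-not x a = ⊕-cancelˡ≡ P (begin
    P ⊕ P ⊗ Q        ≈⟨ ⊕-cong≡ (≡[]-sym (A-idempotent x a)) (≈⇒≡[] ≈-refl) ⟩
    P ⊗ P ⊕ P ⊗ Q    ≈⟨ ≈⇒≡[] (≈-sym (⊗-distribˡ P P Q)) ⟩
    P ⊗ (P ⊕ Q)      ≈⟨ ⊗-cong≡ʳ P (A-complement x a) ℕₚ.≤-refl ⟩
    P ⊗ const 1r     ≈⟨ ≈⇒≡[] (≈-trans (⊗-identityʳ P) (≈-sym (⊕-identityʳ P))) ⟩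
    P ⊕ []           ∎)
    where
    open SetoidReasoning (≡[]-setoid 2)
    P Q : Polynomial
    P = A x a
    Q = A x (not a)

  A-orthogonal : ∀ x {a b} → a ≢ b → A x a ⊗ A x b ≡[ 2 ] []
  A-orthogonal x {false} {false} a≢b = ⊥-elim (a≢b refl)
  A-orthogonal x {false} {true}  _   = A-orthogonal-not x false
  A-orthogonal x {true}  {false} _   = A-orthogonal-not x true
  A-orthogonal x {true}  {true}  a≢b = ⊥-elim (a≢b refl)

  χ-split₁ : ∀ i α → χ i α ≈ ℓ₁ i α ⊗ (ℓ₂ i α ⊗ ℓ₃ i α)
  χ-split₁ i α = ⊗-assoc (ℓ₁ i α) (ℓ₂ i α) (ℓ₃ i α)

  χ-split₂ : ∀ i α → χ i α ≈ ℓ₂ i α ⊗ (ℓ₁ i α ⊗ ℓ₃ i α)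
  χ-split₂ i α =
    ≈-trans (⊗-congˡ (ℓ₃ i α) (⊗-comm (ℓ₁ i α) (ℓ₂ i α))) (⊗-assoc (ℓ₂ i α) (ℓ₁ i α) (ℓ₃ i α))

  χ-split₃ : ∀ i α → χ i α ≈ ℓ₃ i α ⊗ (ℓ₁ i α ⊗ ℓ₂ i α)
  χ-split₃ i α = ⊗-comm (ℓ₁ i α ⊗ ℓ₂ i α) (ℓ₃ i α)

  χ-absorbs : ∀ i α {p q} → χ i α ≈ p ⊗ q → p ⊗ p ≡[ 2 ] p → deg q ≤ℕ 2 → χ i α ⊗ p ≡[ 4 ] χ i α
  χ-absorbs i α {p} {q} χ≈pq pp≡p deg-q≤2 = begin
    χ i α ⊗ p      ≈⟨ ≈⇒≡[] (⊗-congˡ p χ≈pq) ⟩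
    (p ⊗ q) ⊗ p    ≈⟨ ⊗-absorbs p q pp≡p deg-q≤2 ⟩
    p ⊗ q          ≈⟨ ≈⇒≡[] (≈-sym χ≈pq) ⟩
    χ i α          ∎
    where open SetoidReasoning (≡[]-setoid 4)

  χ-absorbs₁ : ∀ i α → χ i α ⊗ ℓ₁ i α ≡[ 4 ] χ i α
  χ-absorbs₁ i α = χ-absorbs i α (χ-split₁ i α) (A-idempotent _ _) ℕₚ.≤-refl

  χ-absorbs₂ : ∀ i α → χ i α ⊗ ℓ₂ i α ≡[ 4 ] χ i α
  χ-absorbs₂ i α = χ-absorbs i α (χ-split₂ i α) (A-idempotent _ _) ℕₚ.≤-refl

  χ-absorbs₃ : ∀ i α → χ i α ⊗ ℓ₃ i α ≡[ 4 ] χ i α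
  χ-absorbs₃ i α = χ-absorbs i α (χ-split₃ i α) (A-idempotent _ _) ℕₚ.≤-refl

  χ-idempotent : ∀ i α → χ i α ⊗ χ i α ≡[ 6 ] χ i α
  χ-idempotent i α = begin
    χ i α ⊗ ((p₁ ⊗ p₂) ⊗ p₃)   ≈⟨ ≈⇒≡[] regroup ⟩
    ((χ i α ⊗ p₁) ⊗ p₂) ⊗ p₃   ≈⟨ ⊗-cong≡ˡ p₃ (⊗-cong≡ˡ p₂ (χ-absorbs₁ i α) ℕₚ.≤-refl) ℕₚ.≤-refl ⟩
    (χ i α ⊗ p₂) ⊗ p₃          ≈⟨ ≡[]-mono (ℕₚ.n≤1+n 5) (⊗-cong≡ˡ p₃ (χ-absorbs₂ i α) ℕₚ.≤-refl) ⟩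
    χ i α ⊗ p₃                 ≈⟨ ≡[]-mono (ℕₚ.m≤m+n 4 2) (χ-absorbs₃ i α) ⟩
    χ i α                      ∎
    where
    open SetoidReasoning (≡[]-setoid 6)
    p₁ p₂ p₃ : Polynomial
    p₁ = ℓ₁ i α
    p₂ = ℓ₂ i α
    p₃ = ℓ₃ i α
    regroup : χ i α ⊗ ((p₁ ⊗ p₂) ⊗ p₃) ≈ ((χ i α ⊗ p₁) ⊗ p₂) ⊗ p₃
    regroup = ≈-trans (≈-sym (⊗-assoc (χ i α) (p₁ ⊗ p₂) p₃))
                      (⊗-congˡ p₃ (≈-sym (⊗-assoc (χ i α) p₁ p₂)))

  -- Distinct assignments differ in x₁ or in x₂ (the value of x₃ is determined by them).
  χ-orthogonal : ∀ i {α β} → α ≢ β → χ i α ⊗ χ i β ≡[ 6 ] []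
  χ-orthogonal i {α@(a₁ , _)} {β@(b₁ , _)} α≢β with a₁ Boolₚ.≟ b₁
  ... | no a₁≢b₁ = ≡[]-trans (≈⇒≡[] (⊗-cong (χ-split₁ i α) (χ-split₁ i β)))
    (⊗-orthogonal (ℓ₁ i α) (ℓ₂ i α ⊗ ℓ₃ i α) (ℓ₁ i β) (ℓ₂ i β ⊗ ℓ₃ i β)
                  (A-orthogonal (x₁ i) a₁≢b₁) ℕₚ.≤-refl)
  ... | yes refl = ≡[]-trans (≈⇒≡[] (⊗-cong (χ-split₂ i α) (χ-split₂ i β)))
    (⊗-orthogonal (ℓ₂ i α) (ℓ₁ i α ⊗ ℓ₃ i α) (ℓ₂ i β) (ℓ₁ i β ⊗ ℓ₃ i β)
                  (A-orthogonal (x₂ i) (α≢β ∘ cong (a₁ ,_))) ℕₚ.≤-refl)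

  χ-product : ∀ i α β → χ i α ⊗ χ i β ≡[ 6 ] when (α ≟₂ β) (χ i α)
  χ-product i α β with α ≟₂ β
  ... | yes refl = χ-idempotent i α
  ... | no α≢β   = χ-orthogonal i α≢β

module Substitution (ℝ : RealField) {I J : Set} (s : J → Polynomials.Polynomial ℝ I) where
  open RealRing ℝ
  open Polynomials ℝ I
  open PolynomialAlgebra ℝ I
  open PolynomialDegree ℝ I
  module Src = Polynomials ℝ J
  module SrcAlg = PolynomialAlgebra ℝ J
  module SrcDeg = PolynomialDegree ℝ J

  substₘ : Src.Monomial → Polynomial
  substₘ []      = const 1r
  substₘ (j ∷ w) = s j ⊗ substₘ w

  σ : Src.Polynomial → Polynomial
  σ = foldr (λ t acc → const (proj₁ t) ⊗ substₘ (proj₂ t) ⊕ acc) []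

  substₘ-↭ : ∀ {w w′} → w ↭ w′ → substₘ w ≈ substₘ w′
  substₘ-↭ ↭.refl          = ≈-refl
  substₘ-↭ (↭.prep j w↭w′) = ⊗-congʳ (s j) (substₘ-↭ w↭w′)
  substₘ-↭ (↭.swap {w} j j′ w↭w′) =
    ≈-trans (≈-sym (⊗-assoc (s j) (s j′) (substₘ w)))
    (≈-trans (⊗-congˡ (substₘ w) (⊗-comm (s j) (s j′)))
    (≈-trans (⊗-assoc (s j′) (s j) (substₘ w))
             (⊗-congʳ (s j′) (⊗-congʳ (s j) (substₘ-↭ w↭w′)))))
  substₘ-↭ (↭.trans w↭w′ w′↭w″) = ≈-trans (substₘ-↭ w↭w′) (substₘ-↭ w′↭w″)

  substₘ-++ : ∀ w w′ → substₘ (w ++ w′) ≈ substₘ w ⊗ substₘ w′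
  substₘ-++ []      w′ = ≈-sym (⊗-identityˡ (substₘ w′))
  substₘ-++ (j ∷ w) w′ =
    ≈-trans (⊗-congʳ (s j) (substₘ-++ w w′)) (≈-sym (⊗-assoc (s j) (substₘ w) (substₘ w′)))

  ⟦σ⟧ : ∀ p L → ⟦ σ p ⟧ L ≡ SrcAlg.⟦ p ⟧ (λ w → ⟦ substₘ w ⟧ L)
  ⟦σ⟧ []            L = refl
  ⟦σ⟧ ((c , w) ∷ p) L =
    trans (⟦⟧-++ (const c ⊗ substₘ w) (σ p) L) (cong₂ _+_ (⟦⟧-const⊗ c (substₘ w) L) (⟦σ⟧ p L))

  ⟦σ⊗⟧ : ∀ p t L → ⟦ σ p ⊗ t ⟧ L ≡ SrcAlg.⟦ p ⟧ (λ w → ⟦ substₘ w ⊗ t ⟧ L)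
  ⟦σ⊗⟧ p t L = begin
    ⟦ σ p ⊗ t ⟧ L                                                  ≡⟨ ⟦⟧-⊗ (σ p) t L ⟩
    ⟦ σ p ⟧ (λ a → ⟦ t ⟧ (λ b → L (a ++ b)))                       ≡⟨ ⟦σ⟧ p _ ⟩
    SrcAlg.⟦ p ⟧ (λ w → ⟦ substₘ w ⟧ (λ a → ⟦ t ⟧ (λ b → L (a ++ b))))
      ≡⟨ SrcAlg.⟦⟧-cong p (λ w → sym (⟦⟧-⊗ (substₘ w) t L)) ⟩
    SrcAlg.⟦ p ⟧ (λ w → ⟦ substₘ w ⊗ t ⟧ L)                        ∎
    where open ≡-Reasoning

  σ-⊗ : ∀ p q → σ (p Src.⊗ q) ≈ σ p ⊗ σ q
  σ-⊗ p q = mk≈ λ L sym-L → begin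
    ⟦ σ (p Src.⊗ q) ⟧ L                                            ≡⟨ ⟦σ⟧ (p Src.⊗ q) L ⟩
    SrcAlg.⟦ p Src.⊗ q ⟧ (λ w → ⟦ substₘ w ⟧ L)                    ≡⟨ SrcAlg.⟦⟧-⊗ p q _ ⟩
    SrcAlg.⟦ p ⟧ (λ w → SrcAlg.⟦ q ⟧ (λ k → ⟦ substₘ (w ++ k) ⟧ L))
      ≡⟨ SrcAlg.⟦⟧-cong p (λ w → SrcAlg.⟦⟧-cong q (λ k → at (split w k) L sym-L)) ⟩
    SrcAlg.⟦ p ⟧ (λ w → SrcAlg.⟦ q ⟧ (λ k → ⟦ substₘ k ⊗ substₘ w ⟧ L))
      ≡⟨ SrcAlg.⟦⟧-cong p (λ w → sym (⟦σ⊗⟧ q (substₘ w) L)) ⟩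
    SrcAlg.⟦ p ⟧ (λ w → ⟦ σ q ⊗ substₘ w ⟧ L)
      ≡⟨ SrcAlg.⟦⟧-cong p (λ w → at (⊗-comm (σ q) (substₘ w)) L sym-L) ⟩
    SrcAlg.⟦ p ⟧ (λ w → ⟦ substₘ w ⊗ σ q ⟧ L)                     ≡⟨ sym (⟦σ⊗⟧ p (σ q) L) ⟩
    ⟦ σ p ⊗ σ q ⟧ L                                                ∎
    where
    open ≡-Reasoning
    split : ∀ w k → substₘ (w ++ k) ≈ substₘ k ⊗ substₘ w
    split w k = ≈-trans (substₘ-++ w k) (⊗-comm (substₘ w) (substₘ k))

  σ-⊕ : ∀ p q → σ (p Src.⊕ q) ≈ σ p ⊕ σ q
  σ-⊕ p q = ≡⇒≈ (σ-++ p)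
    where
    σ-++ : ∀ p → σ (p ++ q) ≡ σ p ++ σ q
    σ-++ []      = refl
    σ-++ (t ∷ p) = trans (cong (_ ++_) (σ-++ p)) (sym (Listₚ.++-assoc _ (σ p) (σ q)))

  σ-⊝ : ∀ p → σ (Src.⊝ p) ≈ ⊝ σ p
  σ-⊝ p = mk≈ λ L _ → begin
    ⟦ σ (Src.⊝ p) ⟧ L                                ≡⟨ ⟦σ⟧ (Src.⊝ p) L ⟩
    SrcAlg.⟦ Src.⊝ p ⟧ (λ w → ⟦ substₘ w ⟧ L)         ≡⟨ SrcAlg.⟦⟧-⊝ p _ ⟩
    - SrcAlg.⟦ p ⟧ (λ w → ⟦ substₘ w ⟧ L)             ≡⟨ cong -_ (sym (⟦σ⟧ p L)) ⟩
    - ⟦ σ p ⟧ L                                      ≡⟨ sym (⟦⟧-⊝ (σ p) L) ⟩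
    ⟦ ⊝ σ p ⟧ L                                      ∎
    where open ≡-Reasoning

  σ-⊖ : ∀ p q → σ (p Src.⊖ q) ≈ σ p ⊖ σ q
  σ-⊖ p q = ≈-trans (σ-⊕ p (Src.⊝ q)) (⊕-cong ≈-refl (σ-⊝ q))

  σ-var : ∀ j → σ (Src.var j) ≈ s j
  σ-var j = ≈-trans (⊕-identityʳ _) (≈-trans (⊗-identityˡ _) (⊗-identityʳ (s j)))

  σ-const : ∀ c → σ (Src.const c) ≈ const c
  σ-const c = ≈-trans (⊕-identityʳ _) (⊗-identityʳ (const c))

  σ-∑ : {X : Set} (f : X → Src.Polynomial) (xs : List X) → σ (Src.∑ (map f xs)) ≈ ∑ (map (σ ∘ f) xs)
  σ-∑ f []       = ≈-refl
  σ-∑ f (x ∷ xs) = ≈-trans (σ-⊕ (f x) (Src.∑ (map f xs))) (⊕-cong ≈-refl (σ-∑ f xs))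

  deg-σ : ∀ {k} → (∀ j → deg (s j) ≤ℕ k) → ∀ p → deg (σ p) ≤ℕ k ℕ.* Src.deg p
  deg-σ {k} deg-s≤k = go
    where
    open ℕₚ.≤-Reasoning
    deg-substₘ : ∀ w → deg (substₘ w) ≤ℕ k ℕ.* length w
    deg-substₘ []      = z≤n
    deg-substₘ (j ∷ w) = begin
      deg (s j ⊗ substₘ w)                  ≤⟨ deg-⊗ (s j) (substₘ w) ⟩
      deg (s j) ℕ.+ deg (substₘ w)          ≤⟨ ℕₚ.+-mono-≤ (deg-s≤k j) (deg-substₘ w) ⟩
      k ℕ.+ k ℕ.* length w                  ≡⟨ sym (ℕₚ.*-suc k (length w)) ⟩
      k ℕ.* suc (length w)                  ∎
    go : ∀ p → deg (σ p) ≤ℕ k ℕ.* Src.deg p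
    go []            = z≤n
    go ((c , w) ∷ p) = begin
      deg (const c ⊗ substₘ w ⊕ σ p)      ≡⟨ deg-++ (const c ⊗ substₘ w) (σ p) ⟩
      deg (const c ⊗ substₘ w) ⊔ deg (σ p)
        ≤⟨ ℕₚ.⊔-mono-≤ (ℕₚ.≤-trans (deg-⊗ (const c) (substₘ w)) (deg-substₘ w)) (go p) ⟩
      k ℕ.* length w ⊔ k ℕ.* Src.deg p    ≡⟨ sym (ℕₚ.*-distribˡ-⊔ k (length w) (Src.deg p)) ⟩
      k ℕ.* (length w ⊔ Src.deg p)        ∎

  pullback : Functional → Src.Functional
  pullback E = record
    { L     = λ w → ⟦ substₘ w ⟧ (Functional.L E)
    ; L-sym = λ w↭w′ → at (substₘ-↭ w↭w′) _ (Functional.L-sym E) }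

  𝔼-pullback : ∀ E p → Src.Functional.𝔼 (pullback E) p ≡ ⟦ σ p ⟧ (Functional.L E)
  𝔼-pullback E p = sym (⟦σ⟧ p (Functional.L E))

module Pullback (ℝ : RealField) {I J : Set} (s : J → Polynomials.Polynomial ℝ I)
                (k : ℕ) .{{_ : ℕ.NonZero k}}
                (deg-s≤k : ∀ j → Polynomials.deg ℝ I (s j) ≤ℕ k)
                (E : Polynomials.Functional ℝ I) (r : ℕ) where
  open RealRing ℝ
  open Polynomials ℝ I
  open PolynomialAlgebra ℝ I
  open PolynomialDegree ℝ I
  open Substitution ℝ s
  open Congruence ℝ I E r
  open Functional E using (L; L-sym)

  E′ : Src.Functional
  E′ = pullback E

  pullback-normalised : Src.Functional.𝔼 E′ (Src.const 1r) ≡ Functional.𝔼 E (const 1r)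
  pullback-normalised = trans (𝔼-pullback E (Src.const 1r)) (at (σ-const 1r) L L-sym)

  private
    scaled : ∀ {a} → a ≤ℕ r / k → k ℕ.* a ≤ℕ r
    scaled {a} a≤r/k = begin
      k ℕ.* a        ≤⟨ ℕₚ.*-monoʳ-≤ k a≤r/k ⟩
      k ℕ.* (r / k)  ≡⟨ ℕₚ.*-comm k (r / k) ⟩
      r / k ℕ.* k    ≤⟨ m/n*n≤m r k ⟩
      r              ∎
      where open ℕₚ.≤-Reasoning

    product-bound : ∀ t p u q → Src.deg ((t ∷ p) Src.⊗ (u ∷ q)) ≤ℕ r / k →
      k ℕ.* Src.deg (t ∷ p) ℕ.+ deg (σ (u ∷ q)) ≤ℕ r
    product-bound t p u q le = begin
      k ℕ.* Src.deg (t ∷ p) ℕ.+ deg (σ (u ∷ q))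
        ≤⟨ ℕₚ.+-monoʳ-≤ (k ℕ.* Src.deg (t ∷ p)) (deg-σ deg-s≤k (u ∷ q)) ⟩
      k ℕ.* Src.deg (t ∷ p) ℕ.+ k ℕ.* Src.deg (u ∷ q)
        ≡⟨ sym (ℕₚ.*-distribˡ-+ k (Src.deg (t ∷ p)) (Src.deg (u ∷ q))) ⟩
      k ℕ.* (Src.deg (t ∷ p) ℕ.+ Src.deg (u ∷ q))
        ≤⟨ scaled (ℕₚ.≤-trans (SrcDeg.deg-⊗-∷ t p u q) le) ⟩
      r ∎
      where open ℕₚ.≤-Reasoning

  pullback-psd : PSD E r → Src.PSD E′ (r / k)
  pullback-psd psd []      _  = IsTotalOrder.refl isTotalOrder
  pullback-psd psd (t ∷ p) le = subst (0r ≤_) (sym 𝔼′[p²]≡𝔼[σp²]) (psd (σ (t ∷ p)) bound)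
    where
    𝔼′[p²]≡𝔼[σp²] : Src.Functional.𝔼 E′ ((t ∷ p) Src.⊗ (t ∷ p)) ≡ ⟦ σ (t ∷ p) ⊗ σ (t ∷ p) ⟧ L
    𝔼′[p²]≡𝔼[σp²] = trans (𝔼-pullback E ((t ∷ p) Src.⊗ (t ∷ p))) (at (σ-⊗ (t ∷ p) (t ∷ p)) L L-sym)
    bound : deg (σ (t ∷ p) ⊗ σ (t ∷ p)) ≤ℕ r
    bound = begin
      deg (σ (t ∷ p) ⊗ σ (t ∷ p))            ≤⟨ deg-⊗ (σ (t ∷ p)) (σ (t ∷ p)) ⟩
      deg (σ (t ∷ p)) ℕ.+ deg (σ (t ∷ p))    ≤⟨ ℕₚ.+-monoˡ-≤ _ (deg-σ deg-s≤k (t ∷ p)) ⟩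
      k ℕ.* Src.deg (t ∷ p) ℕ.+ deg (σ (t ∷ p)) ≤⟨ product-bound t p t p le ⟩
      r                                      ∎
      where open ℕₚ.≤-Reasoning

  σ-vanishing⇒annihilates : ∀ g → (∀ q → k ℕ.* Src.deg g ℕ.+ deg q ≤ℕ r → ⟦ σ g ⊗ q ⟧ L ≡ 0r) →
    Src.Annihilates E′ (r / k) g
  σ-vanishing⇒annihilates []      _        _       _  = refl
  σ-vanishing⇒annihilates (t ∷ g) _        []      _  = begin
    Src.Functional.𝔼 E′ ((t ∷ g) Src.⊗ [])  ≡⟨ 𝔼-pullback E ((t ∷ g) Src.⊗ []) ⟩
    ⟦ σ ((t ∷ g) Src.⊗ []) ⟧ L              ≡⟨ at (≈-trans (σ-⊗ (t ∷ g) []) (⊗-zeroʳ (σ (t ∷ g)))) L L-sym ⟩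
    0r                                      ∎
    where open ≡-Reasoning
  σ-vanishing⇒annihilates (t ∷ g) vanishes (u ∷ q) le = begin
    Src.Functional.𝔼 E′ ((t ∷ g) Src.⊗ (u ∷ q)) ≡⟨ 𝔼-pullback E ((t ∷ g) Src.⊗ (u ∷ q)) ⟩
    ⟦ σ ((t ∷ g) Src.⊗ (u ∷ q)) ⟧ L             ≡⟨ at (σ-⊗ (t ∷ g) (u ∷ q)) L L-sym ⟩
    ⟦ σ (t ∷ g) ⊗ σ (u ∷ q) ⟧ L                 ≡⟨ vanishes (σ (u ∷ q)) (product-bound t g u q le) ⟩
    0r                                          ∎
    where open ≡-Reasoning

  pullback-annihilates : ∀ G H → σ G ≡[ k ℕ.* Src.deg (G Src.⊖ H) ] σ H →
    Src.Annihilates E′ (r / k) (G Src.⊖ H)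
  pullback-annihilates G H σG≡σH = σ-vanishing⇒annihilates (G Src.⊖ H) λ q le →
    trans (at (⊗-congˡ q (σ-⊖ G H)) L L-sym) (≡[]⇒annihilated σG≡σH q le)

module IsomorphismPseudoExpectation (ℝ : RealField) {n m : ℕ} (C : Instance n m) (r : ℕ)
                                    (PE : PseudoExpectation3XOR ℝ C r) where
  open RealRing ℝ
  open Polynomials ℝ (Fin n × Bool)
  open PolynomialAlgebra ℝ (Fin n × Bool)
  open PolynomialDegree ℝ (Fin n × Bool)
  open XORAxioms ℝ C r PE
  open PseudoExpectation3XOR PE using (E)

  C̄ : Instance n m
  C̄ = homogeneous C

  Vertex : Set
  Vertex = Vert n m

  -- The indicator, in terms of A, that the isomorphism induced by the solution maps u to v.
  σᵥ : Vertex × Vertex → Polynomial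
  σᵥ (inj₁ (x , a) , inj₁ (y , b)) = when (x Fin.≟ y) (A x (a xor b))
  σᵥ (inj₂ (i , α) , inj₂ (j , β)) = when (i Fin.≟ j) (χ i (α ⊞ β))
  σᵥ (inj₁ _ , inj₂ _) = []
  σᵥ (inj₂ _ , inj₁ _) = []

  deg-σᵥ : ∀ w → deg (σᵥ w) ≤ℕ 3
  deg-σᵥ (inj₁ (x , a) , inj₁ (y , b)) = ℕₚ.≤-trans (deg-when (x Fin.≟ y) _) (s≤s z≤n)
  deg-σᵥ (inj₂ (i , α) , inj₂ (j , β)) = deg-when (i Fin.≟ j) _
  deg-σᵥ (inj₁ _ , inj₂ _) = z≤n
  deg-σᵥ (inj₂ _ , inj₁ _) = z≤n

  σᵥ-idempotent : ∀ w → σᵥ w ⊗ σᵥ w ≡[ 6 ] σᵥ w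
  σᵥ-idempotent (inj₁ (x , a) , inj₁ (y , b)) with x Fin.≟ y
  ... | yes _ = ≡[]-mono (ℕₚ.m≤m+n 2 4) (A-idempotent x (a xor b))
  ... | no _  = ≈⇒≡[] ≈-refl
  σᵥ-idempotent (inj₂ (i , α) , inj₂ (j , β)) with i Fin.≟ j
  ... | yes _ = χ-idempotent i (α ⊞ β)
  ... | no _  = ≈⇒≡[] ≈-refl
  σᵥ-idempotent (inj₁ _ , inj₂ _) = ≈⇒≡[] ≈-refl
  σᵥ-idempotent (inj₂ _ , inj₁ _) = ≈⇒≡[] ≈-refl

  ∑-A-translate : ∀ x a → ∑ (map (λ b → A x (a xor b)) bools) ≡[ 1 ] const 1r
  ∑-A-translate x false = A-complement x false
  ∑-A-translate x true  = A-complement x true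

  ∑-A-translateʳ : ∀ x b → ∑ (map (λ a → A x (a xor b)) bools) ≡[ 1 ] const 1r
  ∑-A-translateʳ x false = A-complement x false
  ∑-A-translateʳ x true  = A-complement x true

  vertices : List Vertex
  vertices = Graph.vertices G[ C ]

  ∑-vertices : (f : Vertex → Polynomial) → ∑ (map f vertices) ≈
    ∑ (map (λ x → ∑ (map (λ a → f (inj₁ (x , a))) bools)) (allFin n)) ⊕
    ∑ (map (λ i → ∑ (map (λ α → f (inj₂ (i , α))) labels)) (allFin m))
  ∑-vertices f = ≈-trans (∑-++ f (map inj₁ variables) (map inj₂ constraints))
    (⊕-cong (≈-trans (∑-map f inj₁ variables)
                     (∑-concatMap (f ∘ inj₁) (λ x → map (x ,_) bools) (allFin n)))
            (≈-trans (∑-map f inj₂ constraints)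
                     (∑-concatMap (f ∘ inj₂) (λ i → map (i ,_) labels) (allFin m))))
    where
    variables : List (Fin n × Bool)
    variables = concatMap (λ x → map (x ,_) bools) (allFin n)
    constraints : List (Fin m × (Bool × Bool))
    constraints = concatMap (λ i → map (i ,_) labels) (allFin m)

  row-sum : ∀ u → ∑ (map (λ w → σᵥ (u , w)) vertices) ≡[ 3 ] const 1r
  row-sum u@(inj₁ (x , a)) = ≡[]-trans (≈⇒≡[] (begin
    ∑ (map (λ w → σᵥ (u , w)) vertices)
      ≈⟨ ∑-vertices (λ w → σᵥ (u , w)) ⟩
    ∑ (map (λ y → ∑ (map (λ b → when (x Fin.≟ y) (A x (a xor b))) bools)) (allFin n)) ⊕ _
      ≈⟨ ⊕-cong (∑-allFin-diagonalˡ x (λ y d → ∑ (map (λ b → when d (A x (a xor b))) bools))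
                                       (λ _ _ → ≈-refl))
                (∑-zero (allFin m) (λ _ → ≈-refl)) ⟩
    ∑ (map (λ b → A x (a xor b)) bools) ⊕ []
      ≈⟨ ⊕-identityʳ _ ⟩
    ∑ (map (λ b → A x (a xor b)) bools) ∎))
    (≡[]-mono (s≤s z≤n) (∑-A-translate x a))
    where open SetoidReasoning ≈-setoid
  row-sum u@(inj₂ (i , α)) = ≡[]-trans (≈⇒≡[] (begin
    ∑ (map (λ w → σᵥ (u , w)) vertices)
      ≈⟨ ∑-vertices (λ w → σᵥ (u , w)) ⟩
    _ ⊕ ∑ (map (λ j → ∑ (map (λ β → when (i Fin.≟ j) (χ i (α ⊞ β))) labels)) (allFin m))
      ≈⟨ ⊕-cong (∑-zero (allFin n) (λ _ → ≈-refl))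
                (∑-allFin-diagonalˡ i (λ j d → ∑ (map (λ β → when d (χ i (α ⊞ β))) labels))
                                       (λ _ _ → ≈-refl)) ⟩
    ∑ (map (λ β → χ i (α ⊞ β)) labels)
      ≈⟨ ∑-labels-translate (χ i) α ⟩
    ∑ (map (χ i) labels) ∎))
    (∑-χ i)
    where open SetoidReasoning ≈-setoid

  column-sum : ∀ w → ∑ (map (λ u → σᵥ (u , w)) vertices) ≡[ 3 ] const 1r
  column-sum w@(inj₁ (y , b)) = ≡[]-trans (≈⇒≡[] (begin
    ∑ (map (λ u → σᵥ (u , w)) vertices)
      ≈⟨ ∑-vertices (λ u → σᵥ (u , w)) ⟩
    ∑ (map (λ x → ∑ (map (λ a → when (x Fin.≟ y) (A x (a xor b))) bools)) (allFin n)) ⊕ _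
      ≈⟨ ⊕-cong (∑-allFin-diagonalʳ y (λ x d → ∑ (map (λ a → when d (A x (a xor b))) bools))
                                       (λ _ _ → ≈-refl))
                (∑-zero (allFin m) (λ _ → ≈-refl)) ⟩
    ∑ (map (λ a → A y (a xor b)) bools) ⊕ []
      ≈⟨ ⊕-identityʳ _ ⟩
    ∑ (map (λ a → A y (a xor b)) bools) ∎))
    (≡[]-mono (s≤s z≤n) (∑-A-translateʳ y b))
    where open SetoidReasoning ≈-setoid
  column-sum w@(inj₂ (j , β)) = ≡[]-trans (≈⇒≡[] (begin
    ∑ (map (λ u → σᵥ (u , w)) vertices)
      ≈⟨ ∑-vertices (λ u → σᵥ (u , w)) ⟩
    _ ⊕ ∑ (map (λ i → ∑ (map (λ α → when (i Fin.≟ j) (χ i (α ⊞ β))) labels)) (allFin m))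
      ≈⟨ ⊕-cong (∑-zero (allFin n) (λ _ → ≈-refl))
                (∑-allFin-diagonalʳ j (λ i d → ∑ (map (λ α → when d (χ i (α ⊞ β))) labels))
                                       (λ _ _ → ≈-refl)) ⟩
    ∑ (map (λ α → χ j (α ⊞ β)) labels)
      ≈⟨ ∑-labels-translateʳ (χ j) β ⟩
    ∑ (map (χ j) labels) ∎))
    (∑-χ j)
    where open SetoidReasoning ≈-setoid

  ∈-vertices : ∀ u → u ∈ vertices
  ∈-vertices (inj₁ (x , a)) =
    ∈ₚ.∈-++⁺ˡ (∈ₚ.∈-map⁺ inj₁ (∈ₚ.∈-concat⁺′ (∈-pairs a) (∈ₚ.∈-map⁺ _ (∈ₚ.∈-allFin x))))
    where
    ∈-pairs : ∀ a → (x , a) ∈ map (x ,_) bools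
    ∈-pairs false = here refl
    ∈-pairs true  = there (here refl)
  ∈-vertices (inj₂ (i , α)) =
    ∈ₚ.∈-++⁺ʳ _ (∈ₚ.∈-map⁺ inj₂ (∈ₚ.∈-concat⁺′ (∈-pairs α) (∈ₚ.∈-map⁺ _ (∈ₚ.∈-allFin i))))
    where
    ∈-pairs : ∀ α → (i , α) ∈ map (i ,_) labels
    ∈-pairs (false , false) = here refl
    ∈-pairs (false , true)  = there (here refl)
    ∈-pairs (true , false)  = there (there (here refl))
    ∈-pairs (true , true)   = there (there (there (here refl)))

  open Substitution ℝ σᵥ
  open Pullback ℝ σᵥ 3 deg-σᵥ E r public
    using (E′; pullback-normalised; pullback-psd; pullback-annihilates)

  iso-booleanity : ∀ w → Src.Annihilates E′ (r / 3) (Src.var w Src.⊗ Src.var w Src.⊖ Src.var w)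
  iso-booleanity w = pullback-annihilates (Src.var w Src.⊗ Src.var w) (Src.var w) (begin
    σ (Src.var w Src.⊗ Src.var w)
      ≈⟨ ≈⇒≡[] (≈-trans (σ-⊗ (Src.var w) (Src.var w)) (⊗-cong (σ-var w) (σ-var w))) ⟩
    σᵥ w ⊗ σᵥ w                    ≈⟨ σᵥ-idempotent w ⟩
    σᵥ w                           ≈⟨ ≈⇒≡[] (≈-sym (σ-var w)) ⟩
    σ (Src.var w)                  ∎)
    where open SetoidReasoning (≡[]-setoid 6)

  iso-line : ∀ (f : Vertex → Vertex × Vertex) {u} → u ∈ vertices →
    ∑ (map (σᵥ ∘ f) vertices) ≡[ 3 ] const 1r →
    Src.Annihilates E′ (r / 3) (Src.∑ (map (Src.var ∘ f) vertices) Src.⊖ Src.const 1r)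
  iso-line f u∈V line≡1 = pullback-annihilates line (Src.const 1r)
    (≡[]-mono (ℕₚ.*-monoʳ-≤ 3 (SrcDeg.∈⇒1≤deg-∑var f (Src.const 1r) u∈V)) (begin
      σ line
        ≈⟨ ≈⇒≡[] (≈-trans (σ-∑ (Src.var ∘ f) vertices) (∑-cong vertices (σ-var ∘ f))) ⟩
      ∑ (map (σᵥ ∘ f) vertices)    ≈⟨ line≡1 ⟩
      const 1r                     ≈⟨ ≈⇒≡[] (≈-sym (σ-const 1r)) ⟩
      σ (Src.const 1r)             ∎))
    where
    open SetoidReasoning (≡[]-setoid 3)
    line : Src.Polynomial
    line = Src.∑ (map (Src.var ∘ f) vertices)

  Edge : Set
  Edge = Vertex × Vertex

  edges edgesᴴ : List Edge
  edges  = Graph.edges G[ C ]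
  edgesᴴ = Graph.edges G[ C̄ ]

  edge-pair : Edge → Edge → Polynomial
  edge-pair (u , u′) (v , v′) = σᵥ (u , v) ⊗ σᵥ (u′ , v′) ⊕ σᵥ (u , v′) ⊗ σᵥ (u′ , v)

  edge-image : Edge → Polynomial
  edge-image e = ∑ (map (edge-pair e) edgesᴴ)

  variable-edge : Fin n → Edge
  variable-edge x = inj₁ (x , false) , inj₁ (x , true)

  clique-edge : Fin m → (Bool × Bool) × (Bool × Bool) → Edge
  clique-edge i (α , β) = inj₂ (i , α) , inj₂ (i , β)

  literals : Instance n m → Fin m → Bool × Bool → List (Fin n × Bool)
  literals D i (a₁ , a₂) =
      (XORConstraint.x₁ (D i) , a₁)
    ∷ (XORConstraint.x₂ (D i) , a₂)
    ∷ (XORConstraint.x₃ (D i) , third (D i) a₁ a₂)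
    ∷ []

  incidence-edges : Instance n m → Fin m → Bool × Bool → List Edge
  incidence-edges D i α = map (λ ℓ → inj₂ (i , α) , inj₁ ℓ) (literals D i α)

  ∑-edgesᴴ : (f : Edge → Polynomial) → ∑ (map f edgesᴴ) ≈
    ∑ (map (f ∘ variable-edge) (allFin n)) ⊕
    (∑ (map (λ j → ∑ (map (f ∘ clique-edge j) (pairs labels))) (allFin m)) ⊕
     ∑ (map (λ j → ∑ (map (λ γ → ∑ (map f (incidence-edges C̄ j γ))) labels)) (allFin m)))
  ∑-edgesᴴ f = ≈-trans (∑-++ f (map variable-edge (allFin n)) (cliques ++ incidences))
    (⊕-cong (∑-map f variable-edge (allFin n))
      (≈-trans (∑-++ f cliques incidences)
        (⊕-cong (≈-trans (∑-concatMap f (λ j → map (clique-edge j) (pairs labels)) (allFin m))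
                         (∑-cong (allFin m) (λ j → ∑-map f (clique-edge j) (pairs labels))))
                (≈-trans (∑-concatMap f (λ j → concatMap (incidence-edges C̄ j) labels) (allFin m))
                         (∑-cong (allFin m) (λ j → ∑-concatMap f (incidence-edges C̄ j) labels))))))
    where
    cliques incidences : List Edge
    cliques    = concatMap (λ j → map (clique-edge j) (pairs labels)) (allFin m)
    incidences = concatMap (λ j → concatMap (incidence-edges C̄ j) labels) (allFin m)

  ∑-incidence-edges-vanish : ∀ e j γ → (∀ ℓ → edge-pair e (inj₂ (j , γ) , inj₁ ℓ) ≈ []) →
    ∑ (map (edge-pair e) (incidence-edges C̄ j γ)) ≈ []
  ∑-incidence-edges-vanish e j γ vanish =
    ≈-trans (∑-map (edge-pair e) (λ ℓ → inj₂ (j , γ) , inj₁ ℓ) (literals C̄ j γ))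
            (∑-zero (literals C̄ j γ) vanish)

  variable-edge-image : ∀ x → edge-image (variable-edge x) ≡[ 6 ] const 1r
  variable-edge-image x = begin
    edge-image (variable-edge x)  ≈⟨ ≈⇒≡[] only-variable-edge-x ⟩
    P ⊗ P ⊕ Q ⊗ Q
      ≈⟨ ≡[]-mono (ℕₚ.m≤m+n 2 4) (⊕-cong≡ (A-idempotent x false) (A-idempotent x true)) ⟩
    P ⊕ Q                         ≈⟨ ≡[]-mono (ℕₚ.m≤m+n 1 5) (A-complement x false) ⟩
    const 1r                      ∎
    where
    open SetoidReasoning (≡[]-setoid 6)
    P Q : Polynomial
    P = A x false
    Q = A x true
    only-variable-edge-x : edge-image (variable-edge x) ≈ P ⊗ P ⊕ Q ⊗ Q
    only-variable-edge-x = ≈-trans (∑-edgesᴴ (edge-pair (variable-edge x)))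
      (≈-trans (⊕-cong (∑-allFin-diagonalˡ x (λ y d → when d P ⊗ when d P ⊕ when d Q ⊗ when d Q)
                                              (λ _ _ → ≈-refl))
                       (⊕-cong (∑-zero (allFin m) (λ _ → ≈-refl))
                               (∑-zero (allFin m) λ j → ∑-zero labels λ γ →
                                  ∑-incidence-edges-vanish (variable-edge x) j γ
                                    (λ ℓ → ⊗-zeroʳ (σᵥ (inj₁ (x , false) , inj₁ ℓ))))))
               (⊕-identityʳ (P ⊗ P ⊕ Q ⊗ Q)))

  coincidences : Fin m → (Bool × Bool) × (Bool × Bool) → Polynomial
  coincidences i (α , β) = ∑ (map (λ (γ , δ) →
    when (α ⊞ γ ≟₂ β ⊞ δ) (χ i (α ⊞ γ)) ⊕ when (α ⊞ δ ≟₂ β ⊞ γ) (χ i (α ⊞ δ))) (pairs labels))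

  -- For α ≠ β exactly two clique edges {γ , δ} have γ + δ = α + β, and they cover all four labels.
  ∑-coincidences : ∀ i → All (λ αβ → coincidences i αβ ≈ ∑ (map (χ i) labels)) (pairs labels)
  ∑-coincidences i =
      ≈-refl
    ∷ prove 4 (summands (# 0) (# 2) (# 1) (# 3)) in-order (values (χ i))
    ∷ prove 4 (summands (# 0) (# 3) (# 1) (# 2)) in-order (values (χ i))
    ∷ prove 4 (summands (# 1) (# 2) (# 0) (# 3)) in-order (values (χ i))
    ∷ prove 4 (summands (# 1) (# 3) (# 0) (# 2)) in-order (values (χ i))
    ∷ prove 4 (summands (# 2) (# 3) (# 0) (# 1)) in-order (values (χ i))
    ∷ []
    where open LabelSums

  clique-edge-image : ∀ i αβ → coincidences i αβ ≈ ∑ (map (χ i) labels) →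
    edge-image (clique-edge i αβ) ≡[ 6 ] const 1r
  clique-edge-image i (α , β) coincide = begin
    edge-image (clique-edge i (α , β))  ≈⟨ ≈⇒≡[] only-clique-i ⟩
    ∑ (map (products id) (pairs labels))
      ≈⟨ ∑-cong≡ (pairs labels) (λ (γ , δ) →
           ⊕-cong≡ (χ-product i (α ⊞ γ) (β ⊞ δ)) (χ-product i (α ⊞ δ) (β ⊞ γ))) ⟩
    coincidences i (α , β)              ≈⟨ ≈⇒≡[] coincide ⟩
    ∑ (map (χ i) labels)                ≈⟨ ≡[]-mono (ℕₚ.m≤m+n 3 3) (∑-χ i) ⟩
    const 1r                            ∎
    where
    open SetoidReasoning (≡[]-setoid 6)
    products : (Polynomial → Polynomial) → (Bool × Bool) × (Bool × Bool) → Polynomial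
    products w (γ , δ) = w (χ i (α ⊞ γ)) ⊗ w (χ i (β ⊞ δ)) ⊕ w (χ i (α ⊞ δ)) ⊗ w (χ i (β ⊞ γ))
    only-clique-i : edge-image (clique-edge i (α , β)) ≈ ∑ (map (products id) (pairs labels))
    only-clique-i = ≈-trans (∑-edgesᴴ (edge-pair (clique-edge i (α , β))))
      (⊕-cong (∑-zero (allFin n) (λ _ → ≈-refl))
              (≈-trans (⊕-cong (∑-allFin-diagonalˡ i (λ j d → ∑ (map (products (when d)) (pairs labels)))
                                                       (λ _ _ → ≈-refl))
                               (∑-zero (allFin m) λ j → ∑-zero labels λ γ →
                                  ∑-incidence-edges-vanish (clique-edge i (α , β)) j γ
                                    (λ ℓ → ⊕-cong (⊗-zeroʳ (σᵥ (inj₂ (i , α) , inj₂ (j , γ)))) ≈-refl)))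
                       (⊕-identityʳ (∑ (map (products id) (pairs labels))))))

  incidence-edge-image : ∀ i α x a →
    (∀ γ → χ i (α ⊞ γ) ⊗ ∑ (map (λ ℓ → σᵥ (inj₁ (x , a) , inj₁ ℓ)) (literals C̄ i γ))
             ≡[ 6 ] χ i (α ⊞ γ)) →
    edge-image (inj₂ (i , α) , inj₁ (x , a)) ≡[ 6 ] const 1r
  incidence-edge-image i α x a meets = begin
    edge-image e                                                ≈⟨ ≈⇒≡[] only-constraint-i ⟩
    ∑ (map (terms id i) labels)                                 ≈⟨ ≈⇒≡[] (∑-cong labels factor) ⟩
    ∑ (map (λ γ → χ i (α ⊞ γ) ⊗ ∑ (map literal (literals C̄ i γ))) labels)
                                                                ≈⟨ ∑-cong≡ labels meets ⟩
    ∑ (map (λ γ → χ i (α ⊞ γ)) labels)                          ≈⟨ ≈⇒≡[] (∑-labels-translate (χ i) α) ⟩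
    ∑ (map (χ i) labels)                                        ≈⟨ ≡[]-mono (ℕₚ.m≤m+n 3 3) (∑-χ i) ⟩
    const 1r                                                    ∎
    where
    open SetoidReasoning (≡[]-setoid 6)
    e : Edge
    e = inj₂ (i , α) , inj₁ (x , a)
    literal : Fin n × Bool → Polynomial
    literal ℓ = σᵥ (inj₁ (x , a) , inj₁ ℓ)
    terms : (Polynomial → Polynomial) → Fin m → Bool × Bool → Polynomial
    terms w j γ = ∑ (map (λ ℓ → w (χ i (α ⊞ γ)) ⊗ literal ℓ ⊕ []) (literals C̄ j γ))
    cliques-vanish : ∀ j γ δ → edge-pair e (clique-edge j (γ , δ)) ≈ []
    cliques-vanish j γ δ = ⊕-cong (⊗-zeroʳ (σᵥ (inj₂ (i , α) , inj₂ (j , γ))))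
                                  (⊗-zeroʳ (σᵥ (inj₂ (i , α) , inj₂ (j , δ))))
    only-constraint-i : edge-image e ≈ ∑ (map (terms id i) labels)
    only-constraint-i = ≈-trans (∑-edgesᴴ (edge-pair e))
      (⊕-cong (∑-zero (allFin n) (λ _ → ≈-refl))
              (⊕-cong (∑-zero (allFin m) λ j → ∑-zero (pairs labels) λ (γ , δ) → cliques-vanish j γ δ)
                      (∑-allFin-diagonalˡ i (λ j d → ∑ (map (terms (when d) j) labels))
                                             (λ _ _ → ≈-refl))))
    factor : ∀ γ → terms id i γ ≈ χ i (α ⊞ γ) ⊗ ∑ (map literal (literals C̄ i γ))
    factor γ = ≈-trans (∑-cong (literals C̄ i γ) (λ ℓ → ⊕-identityʳ (χ i (α ⊞ γ) ⊗ literal ℓ)))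
                       (∑-distribˡ (χ i (α ⊞ γ)) literal (literals C̄ i γ))

  module _ (i : Fin m) (α γ : Bool × Bool) where
    open XORConstraint (C i) using (x₁≢x₂; x₁≢x₃; x₂≢x₃)

    private
      incident : Fin n × Bool → Polynomial
      incident u = ∑ (map (λ ℓ → σᵥ (inj₁ u , inj₁ ℓ)) (literals C̄ i γ))

      meets-literal : ∀ u p → incident u ≈ p → χ i (α ⊞ γ) ⊗ p ≡[ 4 ] χ i (α ⊞ γ) →
        χ i (α ⊞ γ) ⊗ incident u ≡[ 6 ] χ i (α ⊞ γ)
      meets-literal u p incident≈p absorbs =
        ≡[]-trans (≈⇒≡[] (⊗-congʳ (χ i (α ⊞ γ)) incident≈p)) (≡[]-mono (ℕₚ.m≤m+n 4 2) absorbs)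

    -- The distinctness of the three variables of a constraint leaves exactly one literal.
    meets₁ : χ i (α ⊞ γ) ⊗ incident (x₁ i , proj₁ α) ≡[ 6 ] χ i (α ⊞ γ)
    meets₁ = meets-literal (x₁ i , proj₁ α) (ℓ₁ i (α ⊞ γ))
      (≈-trans (⊕-cong (when-yes (x₁ i Fin.≟ x₁ i) refl)
                       (⊕-cong (when-no (x₁ i Fin.≟ x₂ i) x₁≢x₂)
                               (⊕-cong (when-no (x₁ i Fin.≟ x₃ i) x₁≢x₃) ≈-refl)))
               (⊕-identityʳ (ℓ₁ i (α ⊞ γ))))
      (χ-absorbs₁ i (α ⊞ γ))

    meets₂ : χ i (α ⊞ γ) ⊗ incident (x₂ i , proj₂ α) ≡[ 6 ] χ i (α ⊞ γ)
    meets₂ = meets-literal (x₂ i , proj₂ α) (ℓ₂ i (α ⊞ γ))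
      (≈-trans (⊕-cong (when-no (x₂ i Fin.≟ x₁ i) (x₁≢x₂ ∘ sym))
                       (⊕-cong (when-yes (x₂ i Fin.≟ x₂ i) refl)
                               (⊕-cong (when-no (x₂ i Fin.≟ x₃ i) x₂≢x₃) ≈-refl)))
               (⊕-identityʳ (ℓ₂ i (α ⊞ γ))))
      (χ-absorbs₂ i (α ⊞ γ))

    meets₃ : χ i (α ⊞ γ) ⊗ incident (x₃ i , third (C i) (proj₁ α) (proj₂ α)) ≡[ 6 ] χ i (α ⊞ γ)
    meets₃ = meets-literal (x₃ i , third (C i) (proj₁ α) (proj₂ α)) (ℓ₃ i (α ⊞ γ))
      (≈-trans (⊕-cong (when-no (x₃ i Fin.≟ x₁ i) (x₁≢x₃ ∘ sym))
                       (⊕-cong (when-no (x₃ i Fin.≟ x₂ i) (x₂≢x₃ ∘ sym))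
                               (⊕-cong (when-yes (x₃ i Fin.≟ x₃ i) refl) ≈-refl)))
               (≈-trans (⊕-identityʳ (A (x₃ i) third-sum)) (≡⇒≈ (cong (A (x₃ i)) (third-⊞ (C i) α γ)))))
      (χ-absorbs₃ i (α ⊞ γ))
      where
      third-sum : Bool
      third-sum = third (C i) (proj₁ α) (proj₂ α) xor third (C̄ i) (proj₁ γ) (proj₂ γ)

  incidence-edge-images : ∀ i α → All (λ e → edge-image e ≡[ 6 ] const 1r) (incidence-edges C i α)
  incidence-edge-images i α =
      incidence-edge-image i α (x₁ i) (proj₁ α) (meets₁ i α)
    ∷ incidence-edge-image i α (x₂ i) (proj₂ α) (meets₂ i α)
    ∷ incidence-edge-image i α (x₃ i) (third (C i) (proj₁ α) (proj₂ α)) (meets₃ i α)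
    ∷ []

  edge-images : All (λ e → edge-image e ≡[ 6 ] const 1r) edges
  edge-images = Allₚ.++⁺ (Allₚ.map⁺ (All.universal variable-edge-image (allFin n)))
    (Allₚ.++⁺ (Allₚ.concat⁺ (Allₚ.map⁺ (All.universal cliques (allFin m))))
              (Allₚ.concat⁺ (Allₚ.map⁺ (All.universal incidences (allFin m)))))
    where
    cliques : ∀ i → All (λ e → edge-image e ≡[ 6 ] const 1r) (map (clique-edge i) (pairs labels))
    cliques i =
      Allₚ.map⁺ {f = clique-edge i} (All.map (λ {αβ} → clique-edge-image i αβ) (∑-coincidences i))
    incidences : ∀ i →
      All (λ e → edge-image e ≡[ 6 ] const 1r) (concatMap (incidence-edges C i) labels)
    incidences i = Allₚ.concat⁺ (Allₚ.map⁺ (All.universal (incidence-edge-images i) labels))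

  edge-pair-count : Edge → Edge → Src.Polynomial
  edge-pair-count (u , u′) (v , v′) =
    Src.var (u , v) Src.⊗ Src.var (u′ , v′) Src.⊕ Src.var (u , v′) Src.⊗ Src.var (u′ , v)

  edge-count : List Edge → Src.Polynomial
  edge-count es = Src.∑ (map (λ e → Src.∑ (map (edge-pair-count e) edgesᴴ)) es)

  σ-edge-count : ∀ es → σ (edge-count es) ≈ ∑ (map edge-image es)
  σ-edge-count es =
    ≈-trans (σ-∑ _ es) (∑-cong es (λ e → ≈-trans (σ-∑ _ edgesᴴ) (∑-cong edgesᴴ (σ-pair e))))
    where
    σ-product : ∀ w w′ → σ (Src.var w Src.⊗ Src.var w′) ≈ σᵥ w ⊗ σᵥ w′
    σ-product w w′ = ≈-trans (σ-⊗ (Src.var w) (Src.var w′)) (⊗-cong (σ-var w) (σ-var w′))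
    σ-pair : ∀ e f → σ (edge-pair-count e f) ≈ edge-pair e f
    σ-pair (u , u′) (v , v′) =
      ≈-trans (σ-⊕ (Src.var (u , v) Src.⊗ Src.var (u′ , v′)) (Src.var (u , v′) Src.⊗ Src.var (u′ , v)))
              (⊕-cong (σ-product (u , v) (u′ , v′)) (σ-product (u , v′) (u′ , v)))

  ∈-edgesᴴ : Vertex → ∃ (_∈ edgesᴴ)
  ∈-edgesᴴ (inj₁ (x , _)) = variable-edge x , ∈ₚ.∈-++⁺ˡ (∈ₚ.∈-map⁺ variable-edge (∈ₚ.∈-allFin x))
  ∈-edgesᴴ (inj₂ (i , _)) = clique-edge i ((false , false) , (false , true)) ,
    ∈ₚ.∈-++⁺ʳ (map variable-edge (allFin n)) (∈ₚ.∈-++⁺ˡ (∈ₚ.∈-concat⁺′ (here refl)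
      (∈ₚ.∈-map⁺ (λ j → map (clique-edge j) (pairs labels)) (∈ₚ.∈-allFin i))))

  2≤deg-edge-count : ∀ e es c → 2 ≤ℕ Src.deg (edge-count (e ∷ es) Src.⊖ c)
  2≤deg-edge-count e@(u , _) es c = at-least-2 edgesᴴ (proj₂ (∈-edgesᴴ u))
    where
    rest : List Edge → Src.Polynomial
    rest fs = (Src.∑ (map (edge-pair-count e) fs) Src.⊕ edge-count es) Src.⊖ c
    at-least-2 : ∀ fs {f} → f ∈ fs → 2 ≤ℕ Src.deg (rest fs)
    at-least-2 (f ∷ fs) _ = ℕₚ.m≤m⊔n 2 (2 ⊔ Src.deg (rest fs))

  σ-edge-count≡ : ∀ es → All (λ e → edge-image e ≡[ 6 ] const 1r) es →
    σ (edge-count es) ≡[ 3 ℕ.* Src.deg (edge-count es Src.⊖ Src.const (fromℕ (length es))) ]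
      σ (Src.const (fromℕ (length es)))
  σ-edge-count≡ []       []         = ≈⇒≡[] (≈-trans const-0 (≈-sym (σ-const 0r)))
  σ-edge-count≡ (e ∷ es) all≡1 = ≡[]-mono (ℕₚ.*-monoʳ-≤ 3 (2≤deg-edge-count e es total)) (begin
    σ (edge-count (e ∷ es))                 ≈⟨ ≈⇒≡[] (σ-edge-count (e ∷ es)) ⟩
    ∑ (map edge-image (e ∷ es))             ≈⟨ ∑-ones≡ (e ∷ es) all≡1 ⟩
    const (fromℕ (length (e ∷ es)))         ≈⟨ ≈⇒≡[] (≈-sym (σ-const _)) ⟩
    σ total                                 ∎)
    where
    open SetoidReasoning (≡[]-setoid 6)
    total : Src.Polynomial
    total = Src.const (fromℕ (length (e ∷ es)))

  edge-total : Src.Polynomial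
  edge-total = Src.const (fromℕ (length edges))

  iso-edge : Src.NonNegOn E′ (r / 3) (edge-count edges Src.⊖ edge-total)
  iso-edge = SrcAlg.annihilates⇒nonNegOn E′ (r / 3) (edge-count edges Src.⊖ edge-total)
    (pullback-annihilates (edge-count edges) edge-total (σ-edge-count≡ edges edge-images))

lemma4p2 : (ℝ : RealField) → (n m : ℕ) → (C : Instance n m) → (r : ℕ) →
    PseudoExpectation3XOR ℝ C r →
    PseudoExpectationIso ℝ G[ C ] G[ homogeneous C ] (r / 3)
lemma4p2 ℝ n m C r PE = record
  { E          = E′
  ; normalised = trans pullback-normalised (PseudoExpectation3XOR.normalised PE)
  ; booleanity = λ u v → iso-booleanity (u , v)
  ; rows       = λ u → iso-line (u ,_) (∈-vertices u) (row-sum u)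
  ; cols       = λ v → iso-line (_, v) (∈-vertices v) (column-sum v)
  ; edge       = iso-edge
  ; psd        = pullback-psd (PseudoExpectation3XOR.psd PE)
  }
  where open IsomorphismPseudoExpectation ℝ C r PE
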